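{- Let $k\geq 1$ and $n\geq 0$ be integers. Then \[ \left|\mathcal{T}_k(n)\right|=\sum_{\lambda\in\mathcal{D}_k(n)}\bar{\ell}(\lambda)-\sum_{\lambda\in\mathcal{O}_k(n)}\bar{\ell}(\lambda). \]
   Context: A partition of $n$ is a finite nonincreasing sequence of positive integers (its parts) summing to $n$; $\bar{\ell}(\lambda)$ denotes the number of distinct parts of $\lambda$ (distinct part values). For an integer $k\geq 1$: $\mathcal{O}_k(n)$ is the set of partitions of $n$ with no part divisible by $k$; $\mathcal{D}_k(n)$ is the set of partitions of $n$ in which no part occurs $k$ or more times; $\mathcal{T}_k(n)$ is the set of partitions of $n$ in which exactly one part value occurs more than $k$ times and fewer than $2k$ times, while every other part value occurs fewer than $k$ times. -}

module Defs where

open import Data.Nat using (ℕ; zero; suc; _+_; _*_; _∸_; _≤ᵇ_; _<ᵇ_; _≡ᵇ_; _%_)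
open import Data.List using (List; []; _∷_; map; concatMap; filterᵇ; length; deduplicateᵇ; upTo; all)
open import Data.Nat.ListAction using (sum)
open import Data.Bool using (Bool; true; false; _∧_; _∨_; not; if_then_else_)

-- A partition of n is represented as a nonincreasing list of positive
-- integers summing to n.
-- partsAux fuel m n : all partitions of n whose parts are all ≤ m
-- (fuel ≥ n guarantees termination).
partsAux : ℕ → ℕ → ℕ → List (List ℕ)
partsAux fuel    m zero    = [] ∷ []
partsAux zero    m (suc n) = []
partsAux (suc f) m (suc n) =
  concatMap (λ p → map (p ∷_) (partsAux f p (suc n ∸ p)))
            (filterᵇ (λ p → (1 ≤ᵇ p) ∧ (p ≤ᵇ m) ∧ (p ≤ᵇ suc n)) (upTo (suc (suc n))))

partitions : ℕ → List (List ℕ)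
partitions n = partsAux n n n

countᵇ : {A : Set} → (A → Bool) → List A → ℕ
countᵇ P xs = length (filterᵇ P xs)

mult : ℕ → List ℕ → ℕ
mult v λ' = countᵇ (v ≡ᵇ_) λ'

distinctValues : List ℕ → List ℕ
distinctValues λ' = deduplicateᵇ _≡ᵇ_ λ'

distinctParts : List ℕ → ℕ
distinctParts λ' = length (distinctValues λ')

-- k ∣ p as a boolean (k ≥ 1 assumed; for k = 0 we use 0 ∣ p ⇔ p = 0)
divides? : ℕ → ℕ → Bool
divides? zero    p = p ≡ᵇ 0
divides? (suc k) p = (p % suc k) ≡ᵇ 0

isO : ℕ → List ℕ → Bool
isO k λ' = all (λ p → not (divides? k p)) λ'

isD : ℕ → List ℕ → Bool
isD k λ' = all (λ p → mult p λ' <ᵇ k) λ'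

isTwith : ℕ → List ℕ → ℕ → Bool
isTwith k λ' v = (k <ᵇ mult v λ') ∧ (mult v λ' <ᵇ 2 * k)
                 ∧ all (λ p → (p ≡ᵇ v) ∨ (mult p λ' <ᵇ k)) λ'

isT : ℕ → List ℕ → Bool
isT k λ' = countᵇ (isTwith k λ') (distinctValues λ') ≡ᵇ 1

𝒪 : ℕ → ℕ → List (List ℕ)
𝒪 k n = filterᵇ (isO k) (partitions n)

𝒟 : ℕ → ℕ → List (List ℕ)
𝒟 k n = filterᵇ (isD k) (partitions n)

𝒯 : ℕ → ℕ → List (List ℕ)
𝒯 k n = filterᵇ (isT k) (partitions n)

sumDistinct : List (List ℕ) → ℕ
sumDistinct S = sum (map distinctParts S)

-- Every count is the coefficient of qⁿ in a power series built by induction on the largest allowed part m: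
-- grouping partitions by the multiplicity j of m contributes q^(jm), which is the recurrence
-- Y j = A j + qᵐ Y (j + 1). With Gₘ = 1 + qᵐ + ⋯ + q^((k−1)m) this gives D = ∏ Gₘ, O = ∏_{k∤m} 1/(1 − qᵐ) and
--   Σ_𝒟 ℓ̄ − T = D · Σₘ (qᵐ − q^(km)),   Σ_𝒪 ℓ̄ = O · Σ_{k∤m} qᵐ,
-- the first because Gₘ (qᵐ − q^(km)) = (qᵐ + ⋯ + q^((k−1)m)) − (q^((k+1)m) + ⋯ + q^((2k−1)m)).
-- In degrees ≤ n we have Σₘ (qᵐ − q^(km)) = Σ_{k∤m} qᵐ and D = O (Glaisher: multiplied by ∏ 1/(1 − q^(km))
-- both become ∏ 1/(1 − qᵐ)), so the right-hand sides agree. Subtractions are moved across throughout, to stay in ℕ.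

module Submission where

open import Defs

open import Algebra.Bundles using (CommutativeMonoid)
open import Data.Bool using (Bool; true; false; if_then_else_; _∧_; _∨_; not; T)
open import Data.Bool.Properties
  using (T-∧; ∧-zeroʳ; ∧-identityʳ; ∧-assoc; ∨-zeroʳ; ∧-idem; ∧-commutativeMonoid)
open import Data.List
  using (List; []; _∷_; _++_; map; concatMap; filter; filterᵇ; upTo; applyUpTo; replicate; length; and; all)
open import Data.List.Properties
  using (map-++; map-∘; map-cong; map-cong-local; map-applyUpTo; length-++;
         filter-++; filter-none; filter-all; filter-reject; filter-idem)
open import Data.List.Relation.Unary.All as All using (All; []; _∷_)
open import Data.List.Relation.Unary.All.Properties using (all-filter; concat⁺; map⁺; applyUpTo⁺₂; deduplicate⁺)
open import Data.Nat using (ℕ; zero; suc; _≥_; _+_; _*_; _∸_; _≤_; _<_; z≤n; s≤s; _≤ᵇ_; _<ᵇ_; _≡ᵇ_; _%_)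
open import Data.Nat.Properties
open import Algebra.Properties.CommutativeSemigroup +-commutativeSemigroup
  using (xy∙z≈xz∙y; x∙yz≈y∙xz; x∙yz≈z∙xy) renaming (interchange to +-interchange)
open import Data.Nat.Divisibility
  using (_∣_; divides; m%n≡0⇒n∣m; n∣m⇒m%n≡0; _∣?_; _∣0; ∣-refl; ∣m∣n⇒∣m+n; ∣m+n∣m⇒∣n; >⇒∤)
open import Data.Nat.Induction using (<-rec)
open import Data.Nat.ListAction using (sum)
open import Data.Nat.ListAction.Properties using (sum-++)
open import Data.Product using (_×_; _,_; proj₁; proj₂)
open import Function using (_∘_)
open import Function.Bundles using (Equivalence)
open import Relation.Binary using (tri<; tri≈; tri>)
open import Relation.Binary.PropositionalEquality
  using (_≡_; _≢_; _≗_; refl; sym; trans; cong; cong₂; subst; module ≡-Reasoning; _→-setoid_)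
import Relation.Binary.Reasoning.Setoid as SetoidReasoning
open import Relation.Nullary using (¬_; ¬?; Dec; yes; no; does)
open import Relation.Nullary.Decidable using (T?; dec-true; dec-false)

-- Power series over ℕ

Series : Set
Series = ℕ → ℕ

module ≗-Reasoning = SetoidReasoning (ℕ →-setoid ℕ)

≗-sym : {f g : Series} → f ≗ g → g ≗ f
≗-sym p n = sym (p n)

≗-trans : {f g h : Series} → f ≗ g → g ≗ h → f ≗ h
≗-trans p q n = trans (p n) (q n)

𝟘 𝟙 : Series
𝟘 _ = 0
𝟙 zero    = 1
𝟙 (suc n) = 0

infixl 6 _⊕_
infixr 7 _∙_
infixl 7 _⊛_

_⊕_ : Series → Series → Series
(f ⊕ g) n = f n + g n

_∙_ : ℕ → Series → Series
(c ∙ f) n = c * f n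

<ᵇ-true : ∀ {m n} → m < n → (m <ᵇ n) ≡ true
<ᵇ-true = dec-true (_ <? _)

<ᵇ-false : ∀ {m n} → n ≤ m → (m <ᵇ n) ≡ false
<ᵇ-false n≤m = dec-false (_ <? _) (≤⇒≯ n≤m)

iverson : Bool → ℕ
iverson true  = 1
iverson false = 0

infixr 7 _◃_

_◃_ : Bool → Series → Series
true  ◃ f = f
false ◃ f = 𝟘

iverson-◃ : ∀ α f n → iverson α * f n ≡ (α ◃ f) n
iverson-◃ true  f n = *-identityˡ (f n)
iverson-◃ false f n = refl

⊕-cong : {f f′ g g′ : Series} → f ≗ f′ → g ≗ g′ → f ⊕ g ≗ f′ ⊕ g′
⊕-cong p q n = cong₂ _+_ (p n) (q n)

⊕-identityʳ : (f : Series) → f ⊕ 𝟘 ≗ f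
⊕-identityʳ f n = +-identityʳ (f n)

⊕-assoc : (f g h : Series) → (f ⊕ g) ⊕ h ≗ f ⊕ (g ⊕ h)
⊕-assoc f g h n = +-assoc (f n) (g n) (h n)

⊕-interchange : (f g h i : Series) → (f ⊕ g) ⊕ (h ⊕ i) ≗ (f ⊕ h) ⊕ (g ⊕ i)
⊕-interchange f g h i n = +-interchange (f n) (g n) (h n) (i n)

◃-first : ∀ {α β} f g → α ≡ true → β ≡ false → α ◃ f ⊕ β ◃ g ≗ f
◃-first f g refl refl = ⊕-identityʳ f

◃-both : ∀ {α β} f g → α ≡ true → β ≡ true → α ◃ f ⊕ β ◃ g ≗ f ⊕ g
◃-both f g refl refl _ = refl

◃-second : ∀ {α β} f g → α ≡ false → β ≡ true → α ◃ f ⊕ β ◃ g ≗ g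
◃-second f g refl refl _ = refl

◃-neither : ∀ {α β} f g → α ≡ false → β ≡ false → α ◃ f ⊕ β ◃ g ≗ 𝟘
◃-neither f g refl refl _ = refl

∙-identityˡ : (f : Series) → 1 ∙ f ≗ f
∙-identityˡ f n = *-identityˡ (f n)

-- shift₁ f = q f and shift s f = qˢ f
shift₁ : Series → Series
shift₁ f zero    = 0
shift₁ f (suc n) = f n

shift : ℕ → Series → Series
shift zero    f = f
shift (suc s) f = shift₁ (shift s f)

shift-cong : ∀ s {f g} → f ≗ g → shift s f ≗ shift s g
shift-cong zero    p n       = p n
shift-cong (suc s) p zero    = refl
shift-cong (suc s) p (suc n) = shift-cong s p n

shift-⊕ : ∀ s f g → shift s (f ⊕ g) ≗ shift s f ⊕ shift s g
shift-⊕ zero    f g n       = refl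
shift-⊕ (suc s) f g zero    = refl
shift-⊕ (suc s) f g (suc n) = shift-⊕ s f g n

shift-𝟘 : ∀ s → shift s 𝟘 ≗ 𝟘
shift-𝟘 zero    n       = refl
shift-𝟘 (suc s) zero    = refl
shift-𝟘 (suc s) (suc n) = shift-𝟘 s n

shift-+ : ∀ a b f → shift a (shift b f) ≗ shift (a + b) f
shift-+ zero    b f n       = refl
shift-+ (suc a) b f zero    = refl
shift-+ (suc a) b f (suc n) = shift-+ a b f n

shift-below : ∀ s f {n} → n < s → shift s f n ≡ 0
shift-below (suc s) f {zero}  _         = refl
shift-below (suc s) f {suc n} (s≤s n<s) = shift-below s f n<s

shift-at : ∀ s f n → shift s f (s + n) ≡ f n
shift-at zero    f n = refl
shift-at (suc s) f n = shift-at s f n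

shift-coefficient : ∀ s f n → shift s f n ≡ (if s ≤ᵇ n then f (n ∸ s) else 0)
shift-coefficient zero    f n       = refl
shift-coefficient (suc s) f zero    = refl
shift-coefficient (suc s) f (suc n) =
  trans (shift-coefficient s f n) (cong (λ b → if b then f (n ∸ s) else 0) (≤ᵇ-suc s))
  where
  ≤ᵇ-suc : ∀ s → (s ≤ᵇ n) ≡ (suc s ≤ᵇ suc n)
  ≤ᵇ-suc zero    = refl
  ≤ᵇ-suc (suc s) = refl

shift-agree : ∀ s {f g} n → (∀ i → i ≤ n → f i ≡ g i) → shift s f n ≡ shift s g n
shift-agree zero    n       p = p n ≤-refl
shift-agree (suc s) zero    p = refl
shift-agree (suc s) (suc n) p = shift-agree s n (λ i i≤n → p i (m≤n⇒m≤1+n i≤n))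

tail : Series → Series
tail f n = f (suc n)

_⊛_ : Series → Series → Series
(f ⊛ g) zero    = f 0 * g 0
(f ⊛ g) (suc n) = f 0 * g (suc n) + (tail f ⊛ g) n

⊛-agree : ∀ {f f′ g g′} n → (∀ i → i ≤ n → f i ≡ f′ i) → (∀ i → i ≤ n → g i ≡ g′ i) →
          (f ⊛ g) n ≡ (f′ ⊛ g′) n
⊛-agree zero    p q = cong₂ _*_ (p 0 z≤n) (q 0 z≤n)
⊛-agree (suc n) p q = cong₂ _+_ (cong₂ _*_ (p 0 z≤n) (q (suc n) ≤-refl))
  (⊛-agree n (λ i i≤n → p (suc i) (s≤s i≤n)) (λ i i≤n → q i (m≤n⇒m≤1+n i≤n)))

⊛-cong : ∀ {f f′ g g′} → f ≗ f′ → g ≗ g′ → f ⊛ g ≗ f′ ⊛ g′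
⊛-cong p q n = ⊛-agree n (λ i _ → p i) (λ i _ → q i)

⊛-congʳ : ∀ {f f′} g → f ≗ f′ → f ⊛ g ≗ f′ ⊛ g
⊛-congʳ g p = ⊛-cong p (λ _ → refl)

⊛-congˡ : ∀ f {g g′} → g ≗ g′ → f ⊛ g ≗ f ⊛ g′
⊛-congˡ f q = ⊛-cong (λ _ → refl) q

⊛-distribʳ-⊕ : ∀ h f g → (f ⊕ g) ⊛ h ≗ f ⊛ h ⊕ g ⊛ h
⊛-distribʳ-⊕ h f g zero    = *-distribʳ-+ (h 0) (f 0) (g 0)
⊛-distribʳ-⊕ h f g (suc n) =
  trans (cong₂ _+_ (*-distribʳ-+ (h (suc n)) (f 0) (g 0)) (⊛-distribʳ-⊕ h (tail f) (tail g) n))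
        (+-interchange (f 0 * h (suc n)) (g 0 * h (suc n)) _ _)

⊛-distribˡ-⊕ : ∀ f g h → f ⊛ (g ⊕ h) ≗ f ⊛ g ⊕ f ⊛ h
⊛-distribˡ-⊕ f g h zero    = *-distribˡ-+ (f 0) (g 0) (h 0)
⊛-distribˡ-⊕ f g h (suc n) =
  trans (cong₂ _+_ (*-distribˡ-+ (f 0) (g (suc n)) (h (suc n))) (⊛-distribˡ-⊕ (tail f) g h n))
        (+-interchange (f 0 * g (suc n)) (f 0 * h (suc n)) _ _)

∙-⊛ : ∀ c f g → (c ∙ f) ⊛ g ≗ c ∙ (f ⊛ g)
∙-⊛ c f g zero    = *-assoc c (f 0) (g 0)
∙-⊛ c f g (suc n) =
  trans (cong₂ _+_ (*-assoc c (f 0) (g (suc n))) (∙-⊛ c (tail f) g n)) (sym (*-distribˡ-+ c _ _))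

⊛-zeroˡ : ∀ g → 𝟘 ⊛ g ≗ 𝟘
⊛-zeroˡ g zero    = refl
⊛-zeroˡ g (suc n) = ⊛-zeroˡ g n

⊛-zeroʳ : ∀ f → f ⊛ 𝟘 ≗ 𝟘
⊛-zeroʳ f zero    = *-zeroʳ (f 0)
⊛-zeroʳ f (suc n) = cong₂ _+_ (*-zeroʳ (f 0)) (⊛-zeroʳ (tail f) n)

⊛-identityˡ : ∀ g → 𝟙 ⊛ g ≗ g
⊛-identityˡ g zero    = +-identityʳ (g 0)
⊛-identityˡ g (suc n) = trans (cong₂ _+_ (+-identityʳ (g (suc n))) (⊛-zeroˡ g n)) (+-identityʳ (g (suc n)))

shift₁-⊛ : ∀ f g → shift₁ f ⊛ g ≗ shift₁ (f ⊛ g)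
shift₁-⊛ f g zero    = refl
shift₁-⊛ f g (suc n) = refl

⊛-shift₁ : ∀ f g → f ⊛ shift₁ g ≗ shift₁ (f ⊛ g)
⊛-shift₁ f g zero          = *-zeroʳ (f 0)
⊛-shift₁ f g (suc zero)    = trans (cong (f 0 * g 0 +_) (⊛-shift₁ (tail f) g zero)) (+-identityʳ _)
⊛-shift₁ f g (suc (suc n)) = cong (f 0 * g (suc n) +_) (⊛-shift₁ (tail f) g (suc n))

⊛-comm : ∀ f g → f ⊛ g ≗ g ⊛ f
⊛-comm f g zero          = *-comm (f 0) (g 0)
⊛-comm f g (suc zero)    =
  trans (+-comm (f 0 * g 1) (f 1 * g 0)) (cong₂ _+_ (*-comm (f 1) (g 0)) (*-comm (f 0) (g 1)))
⊛-comm f g (suc (suc n)) = begin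
    f 0 * g (2 + n) + (tail f ⊛ g) (suc n)
  ≡⟨ cong (f 0 * g (2 + n) +_) (⊛-comm (tail f) g (suc n)) ⟩
    f 0 * g (2 + n) + (g 0 * f (2 + n) + (tail g ⊛ tail f) n)
  ≡⟨ cong (λ x → f 0 * g (2 + n) + (g 0 * f (2 + n) + x)) (⊛-comm (tail g) (tail f) n) ⟩
    f 0 * g (2 + n) + (g 0 * f (2 + n) + (tail f ⊛ tail g) n)
  ≡⟨ x∙yz≈y∙xz (f 0 * g (2 + n)) (g 0 * f (2 + n)) _ ⟩
    g 0 * f (2 + n) + (f 0 * g (2 + n) + (tail f ⊛ tail g) n)
  ≡⟨ cong (g 0 * f (2 + n) +_) (⊛-comm f (tail g) (suc n)) ⟩
    g 0 * f (2 + n) + (tail g ⊛ f) (suc n) ∎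
  where open ≡-Reasoning

⊛-identityʳ : ∀ f → f ⊛ 𝟙 ≗ f
⊛-identityʳ f = ≗-trans (⊛-comm f 𝟙) (⊛-identityˡ f)

⊛-unfoldˡ : ∀ f g → f ⊛ g ≗ f 0 ∙ g ⊕ shift₁ (tail f ⊛ g)
⊛-unfoldˡ f g zero    = sym (+-identityʳ (f 0 * g 0))
⊛-unfoldˡ f g (suc n) = refl

⊛-assoc : ∀ f g h → (f ⊛ g) ⊛ h ≗ f ⊛ (g ⊛ h)
⊛-assoc f g h zero    = *-assoc (f 0) (g 0) (h 0)
⊛-assoc f g h (suc n) = begin
    ((f ⊛ g) ⊛ h) (suc n)
  ≡⟨ ⊛-congʳ h (⊛-unfoldˡ f g) (suc n) ⟩
    ((f 0 ∙ g ⊕ shift₁ (tail f ⊛ g)) ⊛ h) (suc n)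
  ≡⟨ ⊛-distribʳ-⊕ h (f 0 ∙ g) (shift₁ (tail f ⊛ g)) (suc n) ⟩
    ((f 0 ∙ g) ⊛ h) (suc n) + (shift₁ (tail f ⊛ g) ⊛ h) (suc n)
  ≡⟨ cong₂ _+_ (∙-⊛ (f 0) g h (suc n)) (⊛-assoc (tail f) g h n) ⟩
    f 0 * (g ⊛ h) (suc n) + (tail f ⊛ (g ⊛ h)) n ∎
  where open ≡-Reasoning

shift-⊛ : ∀ s f g → shift s f ⊛ g ≗ shift s (f ⊛ g)
shift-⊛ zero    f g n = refl
shift-⊛ (suc s) f g   = ≗-trans (shift₁-⊛ (shift s f) g) (shift-cong 1 (shift-⊛ s f g))

⊛-shift : ∀ s f g → f ⊛ shift s g ≗ shift s (f ⊛ g)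
⊛-shift zero    f g n = refl
⊛-shift (suc s) f g   = ≗-trans (⊛-shift₁ f (shift s g)) (shift-cong 1 (⊛-shift s f g))

⊛-cancelʳ : ∀ {f g h} N → h 0 ≡ 1 → (∀ n → n ≤ N → (f ⊛ h) n ≡ (g ⊛ h) n) →
            ∀ n → n ≤ N → f n ≡ g n
⊛-cancelʳ {f} {g} {h} N h₀≡1 fh≡gh = <-rec (λ n → n ≤ N → f n ≡ g n) agree
  where
  open ≡-Reasoning
  unit : ∀ e n → h 0 * e n ≡ e n
  unit e n = trans (cong (_* e n) h₀≡1) (*-identityˡ (e n))

  agree : ∀ n → (∀ {i} → i < n → i ≤ N → f i ≡ g i) → n ≤ N → f n ≡ g n
  agree zero    _  0≤N = begin
    f 0         ≡⟨ sym (unit f 0) ⟩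
    (h ⊛ f) 0   ≡⟨ ⊛-comm h f 0 ⟩
    (f ⊛ h) 0   ≡⟨ fh≡gh 0 0≤N ⟩
    (g ⊛ h) 0   ≡⟨ ⊛-comm g h 0 ⟩
    (h ⊛ g) 0   ≡⟨ unit g 0 ⟩
    g 0         ∎
  agree (suc n) ih n<N = +-cancelʳ-≡ _ (f (suc n)) (g (suc n)) (begin
    f (suc n) + (tail h ⊛ f) n       ≡⟨ cong (_+ (tail h ⊛ f) n) (sym (unit f (suc n))) ⟩
    (h ⊛ f) (suc n)                  ≡⟨ ⊛-comm h f (suc n) ⟩
    (f ⊛ h) (suc n)                  ≡⟨ fh≡gh (suc n) n<N ⟩
    (g ⊛ h) (suc n)                  ≡⟨ ⊛-comm g h (suc n) ⟩
    (h ⊛ g) (suc n)                  ≡⟨ cong₂ _+_ (unit g (suc n)) (⊛-agree n (λ _ _ → refl) lower) ⟩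
    g (suc n) + (tail h ⊛ f) n       ∎)
    where
    lower : ∀ i → i ≤ n → g i ≡ f i
    lower i i≤n = sym (ih (s≤s i≤n) (≤-trans i≤n (<⇒≤ n<N)))

⊛-interchange : ∀ f g h i → (f ⊛ g) ⊛ (h ⊛ i) ≗ (f ⊛ h) ⊛ (g ⊛ i)
⊛-interchange f g h i = begin
  (f ⊛ g) ⊛ (h ⊛ i)    ≈⟨ ⊛-assoc f g (h ⊛ i) ⟩
  f ⊛ (g ⊛ (h ⊛ i))    ≈⟨ ⊛-congˡ f (≗-sym (⊛-assoc g h i)) ⟩
  f ⊛ ((g ⊛ h) ⊛ i)    ≈⟨ ⊛-congˡ f (⊛-congʳ i (⊛-comm g h)) ⟩
  f ⊛ ((h ⊛ g) ⊛ i)    ≈⟨ ⊛-congˡ f (⊛-assoc h g i) ⟩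
  f ⊛ (h ⊛ (g ⊛ i))    ≈⟨ ≗-sym (⊛-assoc f h (g ⊛ i)) ⟩
  (f ⊛ h) ⊛ (g ⊛ i)    ∎
  where open ≗-Reasoning

monomial : ℕ → Series
monomial e = shift e 𝟙

⊛-monomial : ∀ e f → monomial e ⊛ f ≗ shift e f
⊛-monomial e f = ≗-trans (shift-⊛ e 𝟙 f) (shift-cong e (⊛-identityˡ f))

⊛-⊕-monomial : ∀ f g h e → (f ⊛ g) ⊛ (h ⊕ monomial e) ≗ (f ⊛ h) ⊛ g ⊕ f ⊛ shift e g
⊛-⊕-monomial f g h e = begin
  (f ⊛ g) ⊛ (h ⊕ monomial e)                ≈⟨ ⊛-distribˡ-⊕ (f ⊛ g) h (monomial e) ⟩
  (f ⊛ g) ⊛ h ⊕ (f ⊛ g) ⊛ monomial e        ≈⟨ ⊕-cong (⊛-assoc f g h) (⊛-assoc f g (monomial e)) ⟩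
  f ⊛ (g ⊛ h) ⊕ f ⊛ (g ⊛ monomial e)        ≈⟨ ⊕-cong (⊛-congˡ f (⊛-comm g h)) (⊛-congˡ f (⊛-comm g (monomial e))) ⟩
  f ⊛ (h ⊛ g) ⊕ f ⊛ (monomial e ⊛ g)        ≈⟨ ⊕-cong (≗-sym (⊛-assoc f h g)) (⊛-congˡ f (⊛-monomial e g)) ⟩
  (f ⊛ h) ⊛ g ⊕ f ⊛ shift e g               ∎
  where open ≗-Reasoning

-- geometric m = 1 / (1 - qᵐ) for m ≥ 1
geometric : ℕ → Series
geometric m n = if does (m ∣? n) then 1 else 0

geometric-∣ : ∀ {m n} → m ∣ n → geometric m n ≡ 1
geometric-∣ {m} {n} m∣n rewrite dec-true (m ∣? n) m∣n = refl

geometric-∤ : ∀ {m n} → ¬ m ∣ n → geometric m n ≡ 0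
geometric-∤ {m} {n} m∤n rewrite dec-false (m ∣? n) m∤n = refl

geometric-+ : ∀ m n → geometric m (m + n) ≡ geometric m n
geometric-+ m n = by-cases (m ∣? n)
  where
  by-cases : Dec (m ∣ n) → geometric m (m + n) ≡ geometric m n
  by-cases (yes m∣n) = trans (geometric-∣ (∣m∣n⇒∣m+n ∣-refl m∣n)) (sym (geometric-∣ m∣n))
  by-cases (no  m∤n) = trans (geometric-∤ (λ m∣m+n → m∤n (∣m+n∣m⇒∣n m∣m+n ∣-refl))) (sym (geometric-∤ m∤n))

geometric-below : ∀ s n → n < suc s → geometric (suc s) n ≡ 𝟙 n
geometric-below s zero    _   = geometric-∣ (suc s ∣0)
geometric-below s (suc n) n<m = geometric-∤ (>⇒∤ n<m)

geometric-unfold : ∀ s → geometric (suc s) ≗ 𝟙 ⊕ shift (suc s) (geometric (suc s))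
geometric-unfold s n with n <? suc s
... | yes n<m = trans (geometric-below s n n<m)
                      (sym (trans (cong (𝟙 n +_) (shift-below (suc s) _ n<m)) (+-identityʳ (𝟙 n))))
... | no  n≮m with m≤n⇒∃[o]m+o≡n (≮⇒≥ n≮m)
...   | o , refl = trans (geometric-+ (suc s) o) (sym (shift-at (suc s) (geometric (suc s)) o))

⊛-geometric : ∀ s f → f ⊛ geometric (suc s) ≗ f ⊕ shift (suc s) (f ⊛ geometric (suc s))
⊛-geometric s f = begin
  f ⊛ geometric (suc s)                               ≈⟨ ⊛-congˡ f (geometric-unfold s) ⟩
  f ⊛ (𝟙 ⊕ shift (suc s) (geometric (suc s)))         ≈⟨ ⊛-distribˡ-⊕ f 𝟙 _ ⟩
  f ⊛ 𝟙 ⊕ f ⊛ shift (suc s) (geometric (suc s))       ≈⟨ ⊕-cong (⊛-identityʳ f) (⊛-shift (suc s) f _) ⟩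
  f ⊕ shift (suc s) (f ⊛ geometric (suc s))           ∎
  where open ≗-Reasoning

⊛-geometric-below : ∀ s f {n} → n < suc s → (f ⊛ geometric (suc s)) n ≡ f n
⊛-geometric-below s f {n} n<m =
  trans (⊛-geometric s f n) (trans (cong (f n +_) (shift-below (suc s) _ n<m)) (+-identityʳ (f n)))

powerSum : ℕ → ℕ → ℕ → Series
powerSum m a zero    = 𝟘
powerSum m a (suc c) = monomial (a * m) ⊕ powerSum m (suc a) c

powerSum-one : ∀ m → powerSum m 0 1 ≗ 𝟙
powerSum-one m = ⊕-identityʳ 𝟙

shift-powerSum : ∀ m a c → shift m (powerSum m a c) ≗ powerSum m (suc a) c
shift-powerSum m a zero    = shift-𝟘 m
shift-powerSum m a (suc c) =
  ≗-trans (shift-⊕ m _ _) (⊕-cong (shift-+ m (a * m) 𝟙) (shift-powerSum m (suc a) c))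

shift*-powerSum : ∀ m a b c → shift (a * m) (powerSum m b c) ≗ powerSum m (a + b) c
shift*-powerSum m zero    b c n = refl
shift*-powerSum m (suc a) b c   = ≗-trans (≗-sym (shift-+ m (a * m) (powerSum m b c)))
  (≗-trans (shift-cong m (shift*-powerSum m a b c)) (shift-powerSum m (a + b) c))

powerSum-snoc : ∀ m a c → powerSum m a (suc c) ≗ powerSum m a c ⊕ monomial ((c + a) * m)
powerSum-snoc m a zero    n = +-comm (monomial (a * m) n) 0
powerSum-snoc m a (suc c) n = begin
  monomial (a * m) n + powerSum m (suc a) (suc c) n
    ≡⟨ cong (monomial (a * m) n +_) (powerSum-snoc m (suc a) c n) ⟩
  monomial (a * m) n + (powerSum m (suc a) c n + monomial ((c + suc a) * m) n)
    ≡⟨ sym (+-assoc (monomial (a * m) n) _ _) ⟩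
  powerSum m a (suc c) n + monomial ((c + suc a) * m) n
    ≡⟨ cong (λ e → powerSum m a (suc c) n + monomial (e * m) n) (+-suc c a) ⟩
  powerSum m a (suc c) n + monomial ((suc c + a) * m) n ∎
  where open ≡-Reasoning

powerSum-split : ∀ m c → powerSum m 1 c ⊕ shift (suc c * m) (powerSum m 0 (suc c)) ≗
                          powerSum m (2 + c) c ⊕ shift m (powerSum m 0 (suc c))
powerSum-split m c n = begin
  P 1 c n + shift (suc c * m) (P 0 (suc c)) n
    ≡⟨ cong (P 1 c n +_) (trans (shift*-powerSum m (suc c) 0 (suc c) n) (cong (λ a → P a (suc c) n) (+-identityʳ (suc c)))) ⟩
  P 1 c n + (monomial (suc c * m) n + P (2 + c) c n)
    ≡⟨ x∙yz≈z∙xy (P 1 c n) (monomial (suc c * m) n) (P (2 + c) c n) ⟩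
  P (2 + c) c n + (P 1 c n + monomial (suc c * m) n)
    ≡⟨ cong (P (2 + c) c n +_) (sym (trans (powerSum-snoc m 1 c n) (cong (λ a → P 1 c n + monomial (a * m) n) (+-comm c 1)))) ⟩
  P (2 + c) c n + P 1 (suc c) n
    ≡⟨ cong (P (2 + c) c n +_) (sym (shift-powerSum m 0 (suc c) n)) ⟩
  P (2 + c) c n + shift m (P 0 (suc c)) n ∎
  where
  open ≡-Reasoning
  P = powerSum m

shift-⊛-powerSum : ∀ f m b c → shift m (f ⊛ powerSum m b c) ≗ f ⊛ powerSum m (suc b) c
shift-⊛-powerSum f m b c = ≗-trans (≗-sym (⊛-shift m f _)) (⊛-congˡ f (shift-powerSum m b c))

shift*-⊛-powerSum : ∀ f m a b c → shift (a * m) (f ⊛ powerSum m b c) ≗ f ⊛ powerSum m (a + b) c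
shift*-⊛-powerSum f m a b c = ≗-trans (≗-sym (⊛-shift (a * m) f _)) (⊛-congˡ f (shift*-powerSum m a b c))

⊛-powerSum-suc : ∀ f m c → f ⊛ powerSum m 0 (suc c) ≗ f ⊕ shift m (f ⊛ powerSum m 0 c)
⊛-powerSum-suc f m c = begin
  f ⊛ (𝟙 ⊕ powerSum m 1 c)              ≈⟨ ⊛-distribˡ-⊕ f 𝟙 _ ⟩
  f ⊛ 𝟙 ⊕ f ⊛ powerSum m 1 c            ≈⟨ ⊕-cong (⊛-identityʳ f) (⊛-congˡ f (≗-sym (shift-powerSum m 0 c))) ⟩
  f ⊕ f ⊛ shift m (powerSum m 0 c)      ≈⟨ ⊕-cong (λ _ → refl) (⊛-shift m f _) ⟩
  f ⊕ shift m (f ⊛ powerSum m 0 c)      ∎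
  where open ≗-Reasoning

record Recurrence (m : ℕ) (A Y : ℕ → Series) : Set where
  constructor recurrence
  field step : ∀ j → Y j ≗ A j ⊕ shift m (Y (suc j))

module _ {m : ℕ} {A Y : ℕ → Series} (rec : Recurrence m A Y) where
  open Recurrence rec

  recurrence-unroll : ∀ {B} a c → (∀ j → a ≤ j → j < a + c → A j ≗ B) →
                      Y a ≗ B ⊛ powerSum m 0 c ⊕ shift (c * m) (Y (a + c))
  recurrence-unroll {B} a zero    _    n =
    sym (cong₂ _+_ (⊛-zeroʳ B n) (cong (λ j → Y j n) (+-identityʳ a)))
  recurrence-unroll {B} a (suc c) A≗B = begin
    Y a                                                              ≈⟨ step a ⟩
    A a ⊕ shift m (Y (suc a))                                        ≈⟨ ⊕-cong first (shift-cong m unrolled) ⟩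
    B ⊕ shift m (B ⊛ powerSum m 0 c ⊕ shift (c * m) (Y (suc a + c))) ≈⟨ ⊕-cong (λ _ → refl) (shift-⊕ m _ _) ⟩
    B ⊕ (shift m (B ⊛ powerSum m 0 c) ⊕ shift m (shift (c * m) _))   ≈⟨ ≗-sym (⊕-assoc B _ _) ⟩
    (B ⊕ shift m (B ⊛ powerSum m 0 c)) ⊕ shift m (shift (c * m) _)   ≈⟨ ⊕-cong (≗-sym (⊛-powerSum-suc B m c)) rest ⟩
    B ⊛ powerSum m 0 (suc c) ⊕ shift (suc c * m) (Y (a + suc c))     ∎
    where
    open ≗-Reasoning
    a<a+1+c : a < a + suc c
    a<a+1+c = subst (a <_) (sym (+-suc a c)) (s≤s (m≤m+n a c))
    first : A a ≗ B
    first = A≗B a ≤-refl a<a+1+c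
    unrolled : Y (suc a) ≗ B ⊛ powerSum m 0 c ⊕ shift (c * m) (Y (suc a + c))
    unrolled = recurrence-unroll (suc a) c
      (λ j a<j j<1+a+c → A≗B j (<⇒≤ a<j) (subst (j <_) (sym (+-suc a c)) j<1+a+c))
    rest : shift m (shift (c * m) (Y (suc a + c))) ≗ shift (suc c * m) (Y (a + suc c))
    rest = ≗-trans (shift-+ m (c * m) _) (λ n → cong (λ j → shift (suc c * m) (Y j) n) (sym (+-suc a c)))

module _ {s : ℕ} {A Y : ℕ → Series} (rec : Recurrence (suc s) A Y) where
  open Recurrence rec

  recurrence-unique : ∀ {B Z} a → (∀ j → a ≤ j → A j ≗ B) → Z ≗ B ⊕ shift (suc s) Z → Y a ≗ Z
  recurrence-unique {B} {Z} a A≗B Z-rec n = <-rec P agree n a ≤-refl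
    where
    open ≡-Reasoning
    P : ℕ → Set
    P n = ∀ j → a ≤ j → Y j n ≡ Z n
    agree : ∀ n → (∀ {i} → i < n → P i) → P n
    agree zero    _  j a≤j = begin
      Y j 0         ≡⟨ step j 0 ⟩
      A j 0 + 0     ≡⟨ cong (_+ 0) (A≗B j a≤j 0) ⟩
      B 0 + 0       ≡⟨ sym (Z-rec 0) ⟩
      Z 0           ∎
    agree (suc n) ih j a≤j = begin
      Y j (suc n)                          ≡⟨ step j (suc n) ⟩
      A j (suc n) + shift s (Y (suc j)) n  ≡⟨ cong₂ _+_ (A≗B j a≤j (suc n)) (shift-agree s n next) ⟩
      B (suc n) + shift s Z n              ≡⟨ sym (Z-rec (suc n)) ⟩
      Z (suc n)                            ∎
      where
      next : ∀ i → i ≤ n → Y (suc j) i ≡ Z i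
      next i i≤n = ih (s≤s i≤n) (suc j) (m≤n⇒m≤1+n a≤j)

  recurrence-geometric : ∀ {B} a → (∀ j → a ≤ j → A j ≗ B) → Y a ≗ B ⊛ geometric (suc s)
  recurrence-geometric {B} a A≗B = recurrence-unique a A≗B (⊛-geometric s B)

  recurrence-finite : ∀ {B} a c → (∀ j → a ≤ j → j < a + c → A j ≗ B) → (∀ j → a + c ≤ j → A j ≗ 𝟘) →
                      Y a ≗ B ⊛ powerSum (suc s) 0 c
  recurrence-finite {B} a c A≗B A≗𝟘 = begin
    Y a                                                         ≈⟨ recurrence-unroll rec a c A≗B ⟩
    B ⊛ powerSum (suc s) 0 c ⊕ shift (c * suc s) (Y (a + c))    ≈⟨ ⊕-cong (λ _ → refl) (shift-cong (c * suc s) vanish) ⟩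
    B ⊛ powerSum (suc s) 0 c ⊕ shift (c * suc s) 𝟘              ≈⟨ ⊕-cong (λ _ → refl) (shift-𝟘 (c * suc s)) ⟩
    B ⊛ powerSum (suc s) 0 c ⊕ 𝟘                                ≈⟨ ⊕-identityʳ _ ⟩
    B ⊛ powerSum (suc s) 0 c                                    ∎
    where
    open ≗-Reasoning
    vanish : Y (a + c) ≗ 𝟘
    vanish = recurrence-unique (a + c) A≗𝟘 (λ n → sym (shift-𝟘 (suc s) n))

-- Both sides solve Y = 1 + qᵐ Y.
powerSum-⊛-geometric : ∀ s k′ → powerSum (suc s) 0 (suc k′) ⊛ geometric (suc k′ * suc s) ≗ geometric (suc s)
powerSum-⊛-geometric s k′ =
  recurrence-unique (recurrence {m = m} {A = λ _ → 𝟙} {Y = λ _ → Y} (λ _ → Y-rec)) 0 (λ _ _ _ → refl) (geometric-unfold s)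
  where
  m = suc s
  k = suc k′
  G = powerSum m 0 k
  g = geometric (k * m)
  Y = G ⊛ g
  telescope : 𝟙 ⊕ shift m G ≗ G ⊕ monomial (k * m)
  telescope = ≗-trans (⊕-cong (λ _ → refl) (shift-powerSum m 0 k))
                      (≗-trans (powerSum-snoc m 0 k) (λ n → cong (λ e → G n + monomial (e * m) n) (+-identityʳ k)))
  Y+ : Y ⊕ shift (k * m) g ≗ g ⊕ shift m Y
  Y+ = begin
    Y ⊕ shift (k * m) g                    ≈⟨ ⊕-cong (λ _ → refl) (≗-sym (⊛-monomial (k * m) g)) ⟩
    G ⊛ g ⊕ monomial (k * m) ⊛ g          ≈⟨ ≗-sym (⊛-distribʳ-⊕ g G (monomial (k * m))) ⟩
    (G ⊕ monomial (k * m)) ⊛ g            ≈⟨ ⊛-congʳ g (≗-sym telescope) ⟩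
    (𝟙 ⊕ shift m G) ⊛ g                   ≈⟨ ⊛-distribʳ-⊕ g 𝟙 (shift m G) ⟩
    𝟙 ⊛ g ⊕ shift m G ⊛ g                 ≈⟨ ⊕-cong (⊛-identityˡ g) (shift-⊛ m G g) ⟩
    g ⊕ shift m Y                          ∎
    where open ≗-Reasoning
  Y-rec : Y ≗ 𝟙 ⊕ shift m Y
  Y-rec n = +-cancelʳ-≡ (shift (k * m) g n) (Y n) (𝟙 n + shift m Y n) (begin
    Y n + shift (k * m) g n                    ≡⟨ Y+ n ⟩
    g n + shift m Y n                          ≡⟨ cong (_+ shift m Y n) (geometric-unfold (s + k′ * m) n) ⟩
    𝟙 n + shift (k * m) g n + shift m Y n      ≡⟨ +-assoc (𝟙 n) _ _ ⟩
    𝟙 n + (shift (k * m) g n + shift m Y n)    ≡⟨ cong (𝟙 n +_) (+-comm (shift (k * m) g n) _) ⟩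
    𝟙 n + (shift m Y n + shift (k * m) g n)    ≡⟨ sym (+-assoc (𝟙 n) _ _) ⟩
    𝟙 n + shift m Y n + shift (k * m) g n      ∎)
    where open ≡-Reasoning

-- Sums over partitions with bounded parts

-- the largest parts partsAux admits for a partition of suc n with parts ≤ m
candidate : ℕ → ℕ → ℕ → Bool
candidate m n p = (1 ≤ᵇ p) ∧ (p ≤ᵇ m) ∧ (p ≤ᵇ suc n)

candidate-bounds : ∀ {m n} p → T (candidate m n p) → 1 ≤ p × p ≤ m
candidate-bounds {m} {n} p t =
  let (1≤p , p≤m∧p≤1+n) = Equivalence.to (T-∧ {1 ≤ᵇ p}) t
  in ≤ᵇ⇒≤ 1 p 1≤p , ≤ᵇ⇒≤ p m (proj₁ (Equivalence.to (T-∧ {p ≤ᵇ m}) p≤m∧p≤1+n))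

candidates-bounded : ∀ m n xs → All (λ p → 1 ≤ p × p ≤ m) (filterᵇ (candidate m n) xs)
candidates-bounded m n xs = All.map (candidate-bounds _) (all-filter (T? ∘ candidate m n) xs)

PartsAtMost : ℕ → List ℕ → Set
PartsAtMost m = All (_≤ m)

partsAux-bounded : ∀ f m n → All (PartsAtMost m) (partsAux f m n)
partsAux-bounded f       m zero    = [] ∷ []
partsAux-bounded zero    m (suc n) = []
partsAux-bounded (suc f) m (suc n) = concat⁺ (map⁺ (All.map extend (candidates-bounded m n (upTo (2 + n)))))
  where
  extend : ∀ {p} → 1 ≤ p × p ≤ m → All (PartsAtMost m) (map (p ∷_) (partsAux f p (suc n ∸ p)))
  extend {p} (_ , p≤m) = map⁺ (All.map (λ parts≤p → p≤m ∷ All.map (λ q≤p → ≤-trans q≤p p≤m) parts≤p)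
                                   (partsAux-bounded f p (suc n ∸ p)))

concatMap-cong-local : ∀ {A B : Set} {F G : A → List B} {xs} → All (λ x → F x ≡ G x) xs →
                       concatMap F xs ≡ concatMap G xs
concatMap-cong-local []       = refl
concatMap-cong-local (e ∷ es) = cong₂ _++_ e (concatMap-cong-local es)

partsAux-fuel : ∀ f g m n → n ≤ f → n ≤ g → partsAux f m n ≡ partsAux g m n
partsAux-fuel f       g       m zero    _         _         = refl
partsAux-fuel (suc f) (suc g) m (suc n) (s≤s n≤f) (s≤s n≤g) =
  concatMap-cong-local (All.map same (candidates-bounded m n (upTo (2 + n))))
  where
  same : ∀ {p} → 1 ≤ p × p ≤ m → map (p ∷_) (partsAux f p (suc n ∸ p)) ≡ map (p ∷_) (partsAux g p (suc n ∸ p))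
  same {suc p} _ = cong (map (suc p ∷_))
    (partsAux-fuel f g (suc p) (n ∸ p) (≤-trans (m∸n≤m n p) n≤f) (≤-trans (m∸n≤m n p) n≤g))

sum-map-concatMap : ∀ {A B : Set} (w : B → ℕ) (F : A → List B) xs →
                    sum (map w (concatMap F xs)) ≡ sum (map (λ x → sum (map w (F x))) xs)
sum-map-concatMap w F []       = refl
sum-map-concatMap w F (x ∷ xs) = trans (cong sum (map-++ w (F x) (concatMap F xs)))
  (trans (sum-++ (map w (F x)) (map w (concatMap F xs))) (cong (sum (map w (F x)) +_) (sum-map-concatMap w F xs)))

sum-map-filterᵇ : ∀ {A : Set} (c : A → Bool) (g : A → ℕ) xs →
                  sum (map g (filterᵇ c xs)) ≡ sum (map (λ x → if c x then g x else 0) xs)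
sum-map-filterᵇ c g []       = refl
sum-map-filterᵇ c g (x ∷ xs) with c x
... | true  = cong (g x +_) (sum-map-filterᵇ c g xs)
... | false = sum-map-filterᵇ c g xs

Σ< : ℕ → (ℕ → ℕ) → ℕ
Σ< N h = sum (applyUpTo h N)

Σ<-cong : ∀ N {g h} → (∀ i → g i ≡ h i) → Σ< N g ≡ Σ< N h
Σ<-cong zero    e = refl
Σ<-cong (suc N) e = cong₂ _+_ (e 0) (Σ<-cong N (λ i → e (suc i)))

Σ<-point : ∀ N a x {g h} → (∀ i → g i ≡ h i + (if i ≡ᵇ a then x else 0)) →
           Σ< N g ≡ Σ< N h + (if a <ᵇ N then x else 0)
Σ<-point zero    a       x e = refl
Σ<-point (suc N) zero    x {g} {h} e = begin
  g 0 + Σ< N (λ i → g (suc i))   ≡⟨ cong₂ _+_ (e 0) (Σ<-cong N (λ i → trans (e (suc i)) (+-identityʳ _))) ⟩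
  h 0 + x + Σ< N (λ i → h (suc i)) ≡⟨ +-assoc (h 0) x _ ⟩
  h 0 + (x + Σ< N (λ i → h (suc i))) ≡⟨ cong (h 0 +_) (+-comm x _) ⟩
  h 0 + (Σ< N (λ i → h (suc i)) + x) ≡⟨ sym (+-assoc (h 0) _ x) ⟩
  h 0 + Σ< N (λ i → h (suc i)) + x ∎
  where open ≡-Reasoning
Σ<-point (suc N) (suc a) x {g} {h} e =
  trans (cong₂ _+_ (trans (e 0) (+-identityʳ (h 0))) (Σ<-point N a x (λ i → e (suc i))))
        (sym (+-assoc (h 0) _ _))

weightSeries : (List ℕ → ℕ) → ℕ → Series
weightSeries w m n = sum (map w (partsAux n m n))

sumWithLargestPart : (List ℕ → ℕ) → ℕ → ℕ → ℕ
sumWithLargestPart w n p = sum (map (λ μ → w (p ∷ μ)) (partsAux n p (suc n ∸ p)))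

weightSeries-unfold : ∀ w m n →
  weightSeries w m (suc n) ≡ Σ< (2 + n) (λ p → if candidate m n p then sumWithLargestPart w n p else 0)
weightSeries-unfold w m n = begin
  sum (map w (concatMap F cands))
    ≡⟨ sum-map-concatMap w F cands ⟩
  sum (map (λ p → sum (map w (F p))) cands)
    ≡⟨ cong sum (map-cong (λ p → cong sum (sym (map-∘ (partsAux n p (suc n ∸ p))))) cands) ⟩
  sum (map (sumWithLargestPart w n) cands)
    ≡⟨ sum-map-filterᵇ (candidate m n) (sumWithLargestPart w n) (upTo (2 + n)) ⟩
  sum (map (λ p → if candidate m n p then sumWithLargestPart w n p else 0) (upTo (2 + n)))
    ≡⟨ cong sum (map-applyUpTo (λ i → i) (λ p → if candidate m n p then sumWithLargestPart w n p else 0) (2 + n)) ⟩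
  Σ< (2 + n) (λ p → if candidate m n p then sumWithLargestPart w n p else 0) ∎
  where
  open ≡-Reasoning
  F : ℕ → List (List ℕ)
  F p = map (p ∷_) (partsAux n p (suc n ∸ p))
  cands = filterᵇ (candidate m n) (upTo (2 + n))

candidate-suc : ∀ (g : ℕ → ℕ) m n p → (if candidate (suc m) n p then g p else 0) ≡
  (if candidate m n p then g p else 0) + (if p ≡ᵇ suc m then (if suc m ≤ᵇ suc n then g (suc m) else 0) else 0)
candidate-suc g m n p with <-cmp p (suc m)
... | tri< p<m _ _ rewrite dec-true (p ≤? suc m) (<⇒≤ p<m) | dec-true (p ≤? m) (≤-pred p<m)
                          | dec-false (p ≟ suc m) (<⇒≢ p<m) = sym (+-identityʳ _)
... | tri≈ _ refl _ rewrite dec-false (suc m ≤? m) (<-irrefl refl) | dec-true (suc m ≤? suc m) ≤-refl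
                          | dec-true (suc m ≟ suc m) refl = refl
... | tri> _ _ m<p rewrite dec-false (p ≤? suc m) (<⇒≱ m<p) | dec-false (p ≤? m) (<⇒≱ (<-trans (n<1+n m) m<p))
                          | dec-false (p ≟ suc m) (>⇒≢ m<p) | ∧-zeroʳ (1 ≤ᵇ p) = refl

weightSeries-largest : ∀ w m →
  weightSeries w (suc m) ≗ weightSeries w m ⊕ shift (suc m) (weightSeries (λ μ → w (suc m ∷ μ)) (suc m))
weightSeries-largest w m zero    = sym (+-identityʳ _)
weightSeries-largest w m (suc n) = begin
  weightSeries w (suc m) (suc n)
    ≡⟨ weightSeries-unfold w (suc m) n ⟩
  Σ< (2 + n) (λ p → if candidate (suc m) n p then G p else 0)
    ≡⟨ Σ<-point (2 + n) (suc m) top (candidate-suc G m n) ⟩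
  Σ< (2 + n) (λ p → if candidate m n p then G p else 0) + (if suc m ≤ᵇ suc n then top else 0)
    ≡⟨ cong₂ _+_ (sym (weightSeries-unfold w m n)) (if-idem (suc m ≤ᵇ suc n)) ⟩
  weightSeries w m (suc n) + top
    ≡⟨ cong (weightSeries w m (suc n) +_) (sym shifted) ⟩
  weightSeries w m (suc n) + shift (suc m) W (suc n) ∎
  where
  open ≡-Reasoning
  G = sumWithLargestPart w n
  W = weightSeries (λ μ → w (suc m ∷ μ)) (suc m)
  top = if suc m ≤ᵇ suc n then G (suc m) else 0
  if-idem : ∀ b → (if b then (if b then G (suc m) else 0) else 0) ≡ (if b then G (suc m) else 0)
  if-idem true  = refl
  if-idem false = refl
  shifted : shift (suc m) W (suc n) ≡ top
  shifted = trans (shift-coefficient (suc m) W (suc n))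
    (cong (λ μs → if suc m ≤ᵇ suc n then sum (map (λ μ → w (suc m ∷ μ)) μs) else 0)
          (partsAux-fuel (n ∸ m) n (suc m) (n ∸ m) ≤-refl (m∸n≤m n m)))

no-candidate-0 : ∀ n p → ¬ T (candidate 0 n p)
no-candidate-0 n zero    ()
no-candidate-0 n (suc p) ()

weightSeries-zero : ∀ w → weightSeries w 0 ≗ w [] ∙ 𝟙
weightSeries-zero w zero    = trans (+-identityʳ (w [])) (sym (*-identityʳ (w [])))
weightSeries-zero w (suc n)
  rewrite filter-none (T? ∘ candidate 0 n) (applyUpTo⁺₂ (λ i → i) (2 + n) (no-candidate-0 n)) =
  sym (*-zeroʳ (w []))

weightSeries-cong : ∀ {w w′} m → (∀ μ → PartsAtMost m μ → w μ ≡ w′ μ) → weightSeries w m ≗ weightSeries w′ m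
weightSeries-cong m w≡w′ n = cong sum (map-cong-local (All.map (w≡w′ _) (partsAux-bounded n m n)))

weightSeries-linear : ∀ m {w} α u β v → (∀ μ → PartsAtMost m μ → w μ ≡ iverson α * u μ + iverson β * v μ) →
                      weightSeries w m ≗ α ◃ weightSeries u m ⊕ β ◃ weightSeries v m
weightSeries-linear m {w} α u β v w≡ n = begin
  weightSeries w m n                                          ≡⟨ weightSeries-cong m w≡ n ⟩
  sum (map (λ μ → a * u μ + b * v μ) μs)                      ≡⟨ sum-linear μs ⟩
  a * weightSeries u m n + b * weightSeries v m n             ≡⟨ cong₂ _+_ (iverson-◃ α _ n) (iverson-◃ β _ n) ⟩
  (α ◃ weightSeries u m ⊕ β ◃ weightSeries v m) n             ∎
  where
  open ≡-Reasoning
  a = iverson α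
  b = iverson β
  μs = partsAux n m n
  sum-linear : ∀ μs → sum (map (λ μ → a * u μ + b * v μ) μs) ≡ a * sum (map u μs) + b * sum (map v μs)
  sum-linear []       = sym (cong₂ _+_ (*-zeroʳ a) (*-zeroʳ b))
  sum-linear (μ ∷ μs) = begin
    a * u μ + b * v μ + sum (map (λ μ → a * u μ + b * v μ) μs)   ≡⟨ cong (a * u μ + b * v μ +_) (sum-linear μs) ⟩
    a * u μ + b * v μ + (a * sum (map u μs) + b * sum (map v μs)) ≡⟨ +-interchange (a * u μ) _ _ _ ⟩
    a * u μ + a * sum (map u μs) + (b * v μ + b * sum (map v μs)) ≡⟨ cong₂ _+_ (sym (*-distribˡ-+ a _ _))
                                                                                (sym (*-distribˡ-+ b _ _)) ⟩
    a * (u μ + sum (map u μs)) + b * (v μ + sum (map v μs))       ∎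

withCopies : (List ℕ → ℕ) → ℕ → ℕ → Series
withCopies w m j = weightSeries (λ μ → w (replicate j (suc m) ++ μ)) (suc m)

weightSeries-multiplicity : ∀ w m →
  Recurrence (suc m) (λ j → weightSeries (λ μ → w (replicate j (suc m) ++ μ)) m) (withCopies w m)
weightSeries-multiplicity w m = recurrence λ j → ≗-trans (weightSeries-largest _ m)
  (⊕-cong (λ _ → refl) (shift-cong (suc m) (weightSeries-cong (suc m) (λ μ _ → cong w (replicate-++-∷ j μ)))))
  where
  replicate-++-∷ : ∀ j μ → replicate j (suc m) ++ suc m ∷ μ ≡ replicate (suc j) (suc m) ++ μ
  replicate-++-∷ zero    μ = refl
  replicate-++-∷ (suc j) μ = cong (suc m ∷_) (replicate-++-∷ j μ)

multiplicity-recurrence : ∀ m {w} (α : ℕ → Bool) u (β : ℕ → Bool) v →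
  (∀ j μ → PartsAtMost m μ → w (replicate j (suc m) ++ μ) ≡ iverson (α j) * u μ + iverson (β j) * v μ) →
  Recurrence (suc m) (λ j → α j ◃ weightSeries u m ⊕ β j ◃ weightSeries v m) (withCopies w m)
multiplicity-recurrence m {w} α u β v w≡ = recurrence λ j →
  ≗-trans (Recurrence.step (weightSeries-multiplicity w m) j)
          (⊕-cong (weightSeries-linear m (α j) u (β j) v (w≡ j)) (λ _ → refl))

length-filterᵇ : ∀ {A : Set} (P : A → Bool) xs → length (filterᵇ P xs) ≡ sum (map (iverson ∘ P) xs)
length-filterᵇ P []       = refl
length-filterᵇ P (x ∷ xs) with P x
... | true  = cong suc (length-filterᵇ P xs)
... | false = length-filterᵇ P xs

countᵇ-++ : ∀ {A : Set} (P : A → Bool) xs ys → countᵇ P (xs ++ ys) ≡ countᵇ P xs + countᵇ P ys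
countᵇ-++ P xs ys = trans (cong length (filter-++ (T? ∘ P) xs ys)) (length-++ (filterᵇ P xs))

countᵇ-replicate : ∀ {A : Set} (P : A → Bool) j x → countᵇ P (replicate j x) ≡ (if P x then j else 0)
countᵇ-replicate P zero    x with P x
... | true  = refl
... | false = refl
countᵇ-replicate P (suc j) x with P x in Px
... | true  = cong suc (trans (countᵇ-replicate P j x) (cong (λ b → if b then j else 0) Px))
... | false = trans (countᵇ-replicate P j x) (cong (λ b → if b then j else 0) Px)

countᵇ-cong-local : ∀ {A : Set} {P Q : A → Bool} {xs} → All (λ x → P x ≡ Q x) xs → countᵇ P xs ≡ countᵇ Q xs
countᵇ-cong-local [] = refl
countᵇ-cong-local {P = P} {Q} {x ∷ _} (Px≡Qx ∷ eqs) with P x | Q x | Px≡Qx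
... | true  | .true  | refl = cong suc (countᵇ-cong-local eqs)
... | false | .false | refl = countᵇ-cong-local eqs

countᵇ-∷ : ∀ {A : Set} (P : A → Bool) x xs → countᵇ P (x ∷ xs) ≡ iverson (P x) + countᵇ P xs
countᵇ-∷ P x xs with P x
... | true  = refl
... | false = refl

countᵇ-none : ∀ {A : Set} (P : A → Bool) {xs} → All (λ x → ¬ T (P x)) xs → countᵇ P xs ≡ 0
countᵇ-none P none = cong length (filter-none (T? ∘ P) none)

countᵇ-∧ˡ : ∀ {A : Set} b (P : A → Bool) xs → countᵇ (λ x → b ∧ P x) xs ≡ (if b then countᵇ P xs else 0)
countᵇ-∧ˡ true  P xs = refl
countᵇ-∧ˡ false P xs = countᵇ-none (λ x → false ∧ P x) {xs} (All.tabulate (λ _ ()))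

all-++ : ∀ {A : Set} (f : A → Bool) xs ys → all f (xs ++ ys) ≡ all f xs ∧ all f ys
all-++ f []       ys = refl
all-++ f (x ∷ xs) ys = trans (cong (f x ∧_) (all-++ f xs ys)) (sym (∧-assoc (f x) _ _))

all-replicate : ∀ {A : Set} (f : A → Bool) j x → all f (replicate j x) ≡ (j ≡ᵇ 0) ∨ f x
all-replicate f zero          x = refl
all-replicate f (suc zero)    x = ∧-identityʳ (f x)
all-replicate f (suc (suc j)) x = trans (cong (f x ∧_) (all-replicate f (suc j) x)) (∧-idem (f x))

all-cong-local : ∀ {A : Set} {f g : A → Bool} {xs} → All (λ x → f x ≡ g x) xs → all f xs ≡ all g xs
all-cong-local eqs = cong and (map-cong-local eqs)

module _ {m′ : ℕ} {μ : List ℕ} (μ≤m′ : PartsAtMost m′ μ) where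
  private
    m = suc m′
    m≢part : All (λ p → ¬ m ≡ p) μ
    m≢part = All.map (λ p≤m′ m≡p → <-irrefl (sym m≡p) (s≤s p≤m′)) μ≤m′

  mult-largest : ∀ j → mult m (replicate j m ++ μ) ≡ j
  mult-largest j = begin
    countᵇ (m ≡ᵇ_) (replicate j m ++ μ)                  ≡⟨ countᵇ-++ (m ≡ᵇ_) (replicate j m) μ ⟩
    countᵇ (m ≡ᵇ_) (replicate j m) + countᵇ (m ≡ᵇ_) μ    ≡⟨ cong₂ _+_ (countᵇ-replicate (m ≡ᵇ_) j m) absent ⟩
    (if m ≡ᵇ m then j else 0) + 0                        ≡⟨ cong (λ b → (if b then j else 0) + 0) (dec-true (m ≟ m) refl) ⟩
    j + 0                                                ≡⟨ +-identityʳ j ⟩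
    j                                                    ∎
    where
    open ≡-Reasoning
    absent : countᵇ (m ≡ᵇ_) μ ≡ 0
    absent = countᵇ-none (m ≡ᵇ_) (All.map (λ m≢p t → m≢p (≡ᵇ⇒≡ m _ t)) m≢part)

  mult-smaller : ∀ j {v} → v ≤ m′ → mult v (replicate j m ++ μ) ≡ mult v μ
  mult-smaller j {v} v≤m′ = trans (countᵇ-++ (v ≡ᵇ_) (replicate j m) μ)
    (cong (_+ mult v μ) (trans (countᵇ-replicate (v ≡ᵇ_) j m)
                               (cong (λ b → if b then j else 0) (dec-false (v ≟ m) (<⇒≢ (s≤s v≤m′))))))

  isD-prepend : ∀ k′ j → isD (suc k′) (replicate j m ++ μ) ≡ (j <ᵇ suc k′) ∧ isD (suc k′) μ
  isD-prepend k′ j = begin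
    all f (replicate j m ++ μ)                     ≡⟨ all-++ f (replicate j m) μ ⟩
    all f (replicate j m) ∧ all f μ                ≡⟨ cong₂ _∧_ (all-replicate f j m) (all-cong-local smaller) ⟩
    ((j ≡ᵇ 0) ∨ (mult m λ′ <ᵇ k)) ∧ isD k μ        ≡⟨ cong (λ x → ((j ≡ᵇ 0) ∨ (x <ᵇ k)) ∧ isD k μ) (mult-largest j) ⟩
    ((j ≡ᵇ 0) ∨ (j <ᵇ k)) ∧ isD k μ               ≡⟨ cong (_∧ isD k μ) (zero-or-below j) ⟩
    (j <ᵇ k) ∧ isD k μ                             ∎
    where
    open ≡-Reasoning
    k = suc k′
    λ′ = replicate j m ++ μ
    f : ℕ → Bool
    f p = mult p λ′ <ᵇ k
    smaller : All (λ p → f p ≡ (mult p μ <ᵇ k)) μ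
    smaller = All.map (λ p≤m′ → cong (_<ᵇ k) (mult-smaller j p≤m′)) μ≤m′
    zero-or-below : ∀ j → ((j ≡ᵇ 0) ∨ (j <ᵇ k)) ≡ (j <ᵇ k)
    zero-or-below zero    = refl
    zero-or-below (suc j) = refl

  isO-prepend : ∀ k j → isO k (replicate j m ++ μ) ≡ ((j ≡ᵇ 0) ∨ not (divides? k m)) ∧ isO k μ
  isO-prepend k j = trans (all-++ notDividing (replicate j m) μ) (cong (_∧ isO k μ) (all-replicate notDividing j m))
    where
    notDividing : ℕ → Bool
    notDividing p = not (divides? k p)

  distinctValues-prepend : ∀ j → distinctValues (replicate (suc j) m ++ μ) ≡ m ∷ distinctValues μ
  distinctValues-prepend j = cong (m ∷_) (without-m j)
    where
    other : ∀ y → Dec (¬ T (m ≡ᵇ y))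
    other y = ¬? (T? (m ≡ᵇ y))
    without-m : ∀ j → filter other (distinctValues (replicate j m ++ μ)) ≡ distinctValues μ
    without-m zero    = filter-all other (deduplicate⁺ _ (All.map (λ m≢p t → m≢p (≡ᵇ⇒≡ m _ t)) m≢part))
    without-m (suc j) = begin
      filter other (m ∷ filter other (distinctValues (replicate j m ++ μ)))
        ≡⟨ filter-reject other {x = m} {xs = filter other (distinctValues (replicate j m ++ μ))} (λ m≢m → m≢m (≡⇒≡ᵇ m m refl)) ⟩
      filter other (filter other (distinctValues (replicate j m ++ μ)))
        ≡⟨ filter-idem other (distinctValues (replicate j m ++ μ)) ⟩
      filter other (distinctValues (replicate j m ++ μ))
        ≡⟨ without-m j ⟩
      distinctValues μ ∎
      where open ≡-Reasoning

  distinctParts-prepend : ∀ j → distinctParts (replicate j m ++ μ) ≡ iverson (not (j ≡ᵇ 0)) + distinctParts μ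
  distinctParts-prepend zero    = refl
  distinctParts-prepend (suc j) = cong length (distinctValues-prepend j)

  isTwith-largest : ∀ k j → isTwith k (replicate j m ++ μ) m ≡ (k <ᵇ j) ∧ (j <ᵇ 2 * k) ∧ isD k μ
  isTwith-largest k j = begin
    (k <ᵇ mult m λ′) ∧ (mult m λ′ <ᵇ 2 * k) ∧ all g λ′
      ≡⟨ cong₂ (λ x b → (k <ᵇ x) ∧ (x <ᵇ 2 * k) ∧ b) (mult-largest j) (all-++ g (replicate j m) μ) ⟩
    (k <ᵇ j) ∧ (j <ᵇ 2 * k) ∧ (all g (replicate j m) ∧ all g μ)
      ≡⟨ cong (λ b → (k <ᵇ j) ∧ (j <ᵇ 2 * k) ∧ b) (cong₂ _∧_ copies (all-cong-local smaller)) ⟩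
    (k <ᵇ j) ∧ (j <ᵇ 2 * k) ∧ isD k μ ∎
    where
    open ≡-Reasoning
    λ′ = replicate j m ++ μ
    g : ℕ → Bool
    g p = (p ≡ᵇ m) ∨ (mult p λ′ <ᵇ k)
    copies : all g (replicate j m) ≡ true
    copies rewrite all-replicate g j m | dec-true (m ≟ m) refl = ∨-zeroʳ (j ≡ᵇ 0)
    smaller : All (λ p → g p ≡ (mult p μ <ᵇ k)) μ
    smaller = All.map (λ {p} p≤m′ → cong₂ _∨_ (dec-false (p ≟ m) (<⇒≢ (s≤s p≤m′))) (cong (_<ᵇ k) (mult-smaller j p≤m′))) μ≤m′

  isTwith-smaller : ∀ k j {v} → v ≤ m′ → isTwith k (replicate (suc j) m ++ μ) v ≡ (suc j <ᵇ k) ∧ isTwith k μ v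
  isTwith-smaller k j {v} v≤m′ = begin
    (k <ᵇ mult v λ′) ∧ (mult v λ′ <ᵇ 2 * k) ∧ all h λ′
      ≡⟨ cong₂ (λ x b → (k <ᵇ x) ∧ (x <ᵇ 2 * k) ∧ b) (mult-smaller (suc j) v≤m′) (all-++ h (replicate (suc j) m) μ) ⟩
    (k <ᵇ mult v μ) ∧ (mult v μ <ᵇ 2 * k) ∧ (all h (replicate (suc j) m) ∧ all h μ)
      ≡⟨ cong (λ b → (k <ᵇ mult v μ) ∧ (mult v μ <ᵇ 2 * k) ∧ b) (cong₂ _∧_ copies (all-cong-local smaller)) ⟩
    (k <ᵇ mult v μ) ∧ (mult v μ <ᵇ 2 * k) ∧ ((suc j <ᵇ k) ∧ all h′ μ)
      ≡⟨ cong ((k <ᵇ mult v μ) ∧_) (x∧yz≡y∧xz (mult v μ <ᵇ 2 * k) (suc j <ᵇ k) _) ⟩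
    (k <ᵇ mult v μ) ∧ ((suc j <ᵇ k) ∧ ((mult v μ <ᵇ 2 * k) ∧ all h′ μ))
      ≡⟨ x∧yz≡y∧xz (k <ᵇ mult v μ) (suc j <ᵇ k) _ ⟩
    (suc j <ᵇ k) ∧ isTwith k μ v ∎
    where
    open ≡-Reasoning
    open import Algebra.Properties.CommutativeSemigroup (CommutativeMonoid.commutativeSemigroup ∧-commutativeMonoid)
      using () renaming (x∙yz≈y∙xz to x∧yz≡y∧xz)
    λ′ = replicate (suc j) m ++ μ
    h h′ : ℕ → Bool
    h  p = (p ≡ᵇ v) ∨ (mult p λ′ <ᵇ k)
    h′ p = (p ≡ᵇ v) ∨ (mult p μ <ᵇ k)
    copies : all h (replicate (suc j) m) ≡ (suc j <ᵇ k)
    copies rewrite all-replicate h (suc j) m | dec-false (m ≟ v) (>⇒≢ (s≤s v≤m′)) =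
      cong (_<ᵇ k) (mult-largest (suc j))
    smaller : All (λ p → h p ≡ h′ p) μ
    smaller = All.map (λ {p} p≤m′ → cong (λ x → (p ≡ᵇ v) ∨ (x <ᵇ k)) (mult-smaller (suc j) p≤m′)) μ≤m′

  isT-prepend : ∀ k′ j → isT (suc k′) (replicate j m ++ μ) ≡
    (if j <ᵇ suc k′ then isT (suc k′) μ else (suc k′ <ᵇ j) ∧ (j <ᵇ 2 * suc k′) ∧ isD (suc k′) μ)
  isT-prepend k′ zero    = refl
  isT-prepend k′ (suc j) = trans (cong (_≡ᵇ 1) count) (exactly-one below atLargest below⇒¬atLargest)
    where
    k = suc k′
    λ′ = replicate (suc j) m ++ μ
    below = suc j <ᵇ k
    atLargest = (k <ᵇ suc j) ∧ (suc j <ᵇ 2 * k) ∧ isD k μ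
    C = countᵇ (isTwith k μ) (distinctValues μ)
    below⇒¬atLargest : below ≡ true → atLargest ≡ false
    below⇒¬atLargest below≡true = cong (_∧ ((suc j <ᵇ 2 * k) ∧ isD k μ)) (<ᵇ-false (<⇒≤ j<k))
      where j<k = <ᵇ⇒< (suc j) k (subst T (sym below≡true) _)
    count : countᵇ (isTwith k λ′) (distinctValues λ′) ≡ iverson atLargest + (if below then C else 0)
    count = begin
      countᵇ (isTwith k λ′) (distinctValues λ′)
        ≡⟨ cong (countᵇ (isTwith k λ′)) (distinctValues-prepend j) ⟩
      countᵇ (isTwith k λ′) (m ∷ distinctValues μ)
        ≡⟨ countᵇ-∷ (isTwith k λ′) m (distinctValues μ) ⟩
      iverson (isTwith k λ′ m) + countᵇ (isTwith k λ′) (distinctValues μ)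
        ≡⟨ cong₂ _+_ (cong iverson (isTwith-largest k (suc j)))
                     (countᵇ-cong-local (All.map (isTwith-smaller k j) (deduplicate⁺ _ μ≤m′))) ⟩
      iverson atLargest + countᵇ (λ v → below ∧ isTwith k μ v) (distinctValues μ)
        ≡⟨ cong (iverson atLargest +_) (countᵇ-∧ˡ below (isTwith k μ) (distinctValues μ)) ⟩
      iverson atLargest + (if below then C else 0) ∎
      where open ≡-Reasoning
    exactly-one : ∀ J B → (J ≡ true → B ≡ false) → (iverson B + (if J then C else 0) ≡ᵇ 1) ≡ (if J then (C ≡ᵇ 1) else B)
    exactly-one true  B     J⇒¬B rewrite J⇒¬B refl = refl
    exactly-one false true  _ = refl
    exactly-one false false _ = refl

-- Generating functions

iverson-∧ : ∀ α β → iverson (α ∧ β) ≡ iverson α * iverson β + iverson false * iverson β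
iverson-∧ true  true  = refl
iverson-∧ true  false = refl
iverson-∧ false β     = refl

iverson-if : ∀ γ τ α β δ → (γ ≡ true → α ≡ false) →
             iverson (if γ then τ else α ∧ β ∧ δ) ≡ iverson γ * iverson τ + iverson (α ∧ β) * iverson δ
iverson-if true  true  α β δ γ⇒¬α rewrite γ⇒¬α refl = refl
iverson-if true  false α β δ γ⇒¬α rewrite γ⇒¬α refl = refl
iverson-if false τ true  true  true  _ = refl
iverson-if false τ true  true  false _ = refl
iverson-if false τ true  false δ     _ = refl
iverson-if false τ false β     δ     _ = refl

distinct-if : ∀ γ δ ζ ℓ → (if γ ∧ δ then iverson ζ + ℓ else 0) ≡
              iverson γ * (if δ then ℓ else 0) + iverson (γ ∧ ζ) * iverson δ
distinct-if false δ     ζ     ℓ = refl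
distinct-if true  false ζ     ℓ = sym (*-zeroʳ (iverson ζ))
distinct-if true  true  false ℓ = sym (trans (+-identityʳ _) (+-identityʳ ℓ))
distinct-if true  true  true  ℓ = trans (+-comm 1 ℓ) (cong (_+ 1) (sym (+-identityʳ ℓ)))

∣-between : ∀ k′ {x c} → suc k′ ∣ x → suc k′ * c < x → x ≤ suc k′ * suc c → x ≡ suc k′ * suc c
∣-between k′ {c = c} (divides q refl) lo hi =
  trans (*-comm q k) (cong (k *_) (≤-antisym (*-cancelˡ-≤ k hi′) (*-cancelˡ-< k c q lo′)))
  where
  k = suc k′
  lo′ : k * c < k * q
  lo′ = subst (k * c <_) (*-comm q k) lo
  hi′ : k * q ≤ k * suc c
  hi′ = subst (_≤ k * suc c) (*-comm q k) hi

module _ (k′ : ℕ) where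
  private
    k : ℕ
    k = suc k′

  inD inO inT ℓ̄inD ℓ̄inO : List ℕ → ℕ
  inD λ′ = iverson (isD k λ′)
  inO λ′ = iverson (isO k λ′)
  inT λ′ = iverson (isT k λ′)
  ℓ̄inD λ′ = if isD k λ′ then distinctParts λ′ else 0
  ℓ̄inO λ′ = if isO k λ′ then distinctParts λ′ else 0

  -- Generating functions over partitions with parts ≤ m, by the multiplicity of the part m: in 𝒯 the part m is
  -- either ordinary (fewer than k copies) or the exceptional part (k + 1 to 2k − 1 copies, the rest in 𝒟), and
  -- the part m adds 1 to ℓ̄ exactly when it occurs.
  gfD gfO gfT gfℓ̄D gfℓ̄O : ℕ → Series
  gfD zero     = 𝟙
  gfD (suc m′) = gfD m′ ⊛ powerSum (suc m′) 0 k
  gfO zero     = 𝟙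
  gfO (suc m′) = if divides? k (suc m′) then gfO m′ else gfO m′ ⊛ geometric (suc m′)
  gfT zero     = 𝟘
  gfT (suc m′) = gfT m′ ⊛ powerSum (suc m′) 0 k ⊕ gfD m′ ⊛ powerSum (suc m′) (suc k) k′
  gfℓ̄D zero     = 𝟘
  gfℓ̄D (suc m′) = gfℓ̄D m′ ⊛ powerSum (suc m′) 0 k ⊕ gfD m′ ⊛ powerSum (suc m′) 1 k′
  gfℓ̄O zero     = 𝟘
  gfℓ̄O (suc m′) = if divides? k (suc m′) then gfℓ̄O m′
                  else gfℓ̄O m′ ⊕ shift (suc m′) ((gfℓ̄O m′ ⊕ gfO m′) ⊛ geometric (suc m′))

  inD-recurrence : ∀ m′ → Recurrence (suc m′) (λ j → (j <ᵇ k) ◃ weightSeries inD m′ ⊕ false ◃ weightSeries inD m′)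
                                              (withCopies inD m′)
  inD-recurrence m′ = multiplicity-recurrence m′ {inD} (_<ᵇ k) inD (λ _ → false) inD
    (λ j μ μ≤m′ → trans (cong iverson (isD-prepend μ≤m′ k′ j)) (iverson-∧ (j <ᵇ k) (isD k μ)))

  weightSeries-inD : ∀ m → weightSeries inD m ≗ gfD m
  weightSeries-inD zero     = ≗-trans (weightSeries-zero inD) (∙-identityˡ 𝟙)
  weightSeries-inD (suc m′) = ≗-trans
    (recurrence-finite (inD-recurrence m′) 0 k
      (λ j _ j<k → ◃-first D D (<ᵇ-true j<k) refl)
      (λ j k≤j → ◃-neither D D (<ᵇ-false k≤j) refl))
    (⊛-congʳ _ (weightSeries-inD m′))
    where D = weightSeries inD m′

  inO-recurrence : ∀ m′ → Recurrence (suc m′) (λ j → ((j ≡ᵇ 0) ∨ not (divides? k (suc m′))) ◃ weightSeries inO m′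
                                                   ⊕ false ◃ weightSeries inO m′)
                                              (withCopies inO m′)
  inO-recurrence m′ = multiplicity-recurrence m′ {inO} (λ j → (j ≡ᵇ 0) ∨ not (divides? k (suc m′))) inO (λ _ → false) inO
    (λ j μ μ≤m′ → trans (cong iverson (isO-prepend μ≤m′ k j)) (iverson-∧ _ (isO k μ)))

  weightSeries-inO : ∀ m → weightSeries inO m ≗ gfO m
  weightSeries-inO zero     = ≗-trans (weightSeries-zero inO) (∙-identityˡ 𝟙)
  weightSeries-inO (suc m′) with divides? k (suc m′) in k∣m
  ... | true  = ≗-trans
    (recurrence-finite (inO-recurrence m′) 0 1
      (λ { zero _ _ → ◃-first O O refl refl ; (suc j) _ (s≤s ()) })
      (λ { (suc j) _ → ◃-neither O O (cong not k∣m) refl }))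
    (≗-trans (⊛-congˡ O (powerSum-one (suc m′))) (≗-trans (⊛-identityʳ O) (weightSeries-inO m′)))
    where O = weightSeries inO m′
  ... | false = ≗-trans
    (recurrence-geometric (inO-recurrence m′) 0
      (λ j _ → ◃-first O O (trans (cong (λ b → (j ≡ᵇ 0) ∨ not b) k∣m) (∨-zeroʳ (j ≡ᵇ 0))) refl))
    (⊛-congʳ _ (weightSeries-inO m′))
    where O = weightSeries inO m′

  inT-recurrence : ∀ m′ → Recurrence (suc m′) (λ j → (j <ᵇ k) ◃ weightSeries inT m′
                                                   ⊕ ((k <ᵇ j) ∧ (j <ᵇ 2 * k)) ◃ weightSeries inD m′)
                                              (withCopies inT m′)
  inT-recurrence m′ = multiplicity-recurrence m′ {inT} (_<ᵇ k) inT (λ j → (k <ᵇ j) ∧ (j <ᵇ 2 * k)) inD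
    (λ j μ μ≤m′ → trans (cong iverson (isT-prepend μ≤m′ k′ j))
                        (iverson-if (j <ᵇ k) (isT k μ) (k <ᵇ j) (j <ᵇ 2 * k) (isD k μ) (j<k⇒k≮j j)))
    where
    j<k⇒k≮j : ∀ j → (j <ᵇ k) ≡ true → (k <ᵇ j) ≡ false
    j<k⇒k≮j j j<k = <ᵇ-false (<⇒≤ (<ᵇ⇒< j k (subst T (sym j<k) _)))

  weightSeries-inT : ∀ m → weightSeries inT m ≗ gfT m
  weightSeries-inT zero     = weightSeries-zero inT
  weightSeries-inT (suc m′) = begin
    Y 0                                                        ≈⟨ recurrence-unroll rec 0 k below-k ⟩
    T′ ⊛ powerSum m 0 k ⊕ shift (k * m) (Y k)                  ≈⟨ ⊕-cong (λ _ → refl) (shift-cong (k * m) from-k) ⟩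
    T′ ⊛ powerSum m 0 k ⊕ shift (k * m) (D ⊛ powerSum m 1 k′)  ≈⟨ ⊕-cong (λ _ → refl) (shift*-⊛-powerSum D m k 1 k′) ⟩
    T′ ⊛ powerSum m 0 k ⊕ D ⊛ powerSum m (k + 1) k′            ≈⟨ ⊕-cong (⊛-congʳ _ (weightSeries-inT m′))
                                                                         (⊛-cong (weightSeries-inD m′) k+1≡1+k) ⟩
    gfT (suc m′)                                               ∎
    where
    open ≗-Reasoning
    m = suc m′
    T′ = weightSeries inT m′
    D = weightSeries inD m′
    rec = inT-recurrence m′
    Y = withCopies inT m′
    2k≡1+k+k′ : 2 * k ≡ suc k + k′
    2k≡1+k+k′ = cong suc (trans (+-suc k′ (k′ + 0)) (cong (λ x → suc (k′ + x)) (+-identityʳ k′)))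
    k+1≡1+k : powerSum m (k + 1) k′ ≗ powerSum m (suc k) k′
    k+1≡1+k n = cong (λ a → powerSum m a k′ n) (+-comm k 1)
    below-k : ∀ j → 0 ≤ j → j < k → (j <ᵇ k) ◃ T′ ⊕ ((k <ᵇ j) ∧ (j <ᵇ 2 * k)) ◃ D ≗ T′
    below-k j _ j<k = ◃-first T′ D (<ᵇ-true j<k) (cong (_∧ (j <ᵇ 2 * k)) (<ᵇ-false (<⇒≤ j<k)))
    at-k : Y k ≗ shift m (Y (suc k))
    at-k = ≗-trans (Recurrence.step rec k)
                   (⊕-cong (◃-neither T′ D (<ᵇ-false {k} ≤-refl) (cong (_∧ (k <ᵇ 2 * k)) (<ᵇ-false {k} ≤-refl))) (λ _ → refl))
    above-k : Y (suc k) ≗ D ⊛ powerSum m 0 k′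
    above-k = recurrence-finite rec (suc k) k′
      (λ j k<j j<2k → ◃-second T′ D (<ᵇ-false (<⇒≤ k<j))
                                     (cong₂ _∧_ (<ᵇ-true k<j) (<ᵇ-true (subst (j <_) (sym 2k≡1+k+k′) j<2k))))
      (λ j 2k≤j → ◃-neither T′ D (<ᵇ-false (≤-trans (≤-trans (n≤1+n k) (m≤m+n (suc k) k′)) 2k≤j))
                                 (trans (cong ((k <ᵇ j) ∧_) (<ᵇ-false (subst (_≤ j) (sym 2k≡1+k+k′) 2k≤j)))
                                        (∧-zeroʳ (k <ᵇ j))))
    from-k : Y k ≗ D ⊛ powerSum m 1 k′
    from-k = ≗-trans at-k (≗-trans (shift-cong m above-k) (shift-⊛-powerSum D m 0 k′))

  ℓ̄inD-recurrence : ∀ m′ → Recurrence (suc m′) (λ j → (j <ᵇ k) ◃ weightSeries ℓ̄inD m′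
                                                    ⊕ ((j <ᵇ k) ∧ not (j ≡ᵇ 0)) ◃ weightSeries inD m′)
                                               (withCopies ℓ̄inD m′)
  ℓ̄inD-recurrence m′ = multiplicity-recurrence m′ {ℓ̄inD} (_<ᵇ k) ℓ̄inD (λ j → (j <ᵇ k) ∧ not (j ≡ᵇ 0)) inD
    (λ j μ μ≤m′ → trans (cong₂ (λ b ℓ → if b then ℓ else 0) (isD-prepend μ≤m′ k′ j) (distinctParts-prepend μ≤m′ j))
                        (distinct-if (j <ᵇ k) (isD k μ) (not (j ≡ᵇ 0)) (distinctParts μ)))

  weightSeries-ℓ̄inD : ∀ m → weightSeries ℓ̄inD m ≗ gfℓ̄D m
  weightSeries-ℓ̄inD zero     = weightSeries-zero ℓ̄inD
  weightSeries-ℓ̄inD (suc m′) = begin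
    Y 0                                             ≈⟨ Recurrence.step rec 0 ⟩
    (L ⊕ 𝟘) ⊕ shift m (Y 1)                        ≈⟨ ⊕-cong (⊕-identityʳ L) (shift-cong m above) ⟩
    L ⊕ shift m ((L ⊕ D) ⊛ powerSum m 0 k′)          ≈⟨ ⊕-cong (λ _ → refl) (shift-⊛-powerSum (L ⊕ D) m 0 k′) ⟩
    L ⊕ (L ⊕ D) ⊛ powerSum m 1 k′                    ≈⟨ ⊕-cong (λ _ → refl) (⊛-distribʳ-⊕ _ L D) ⟩
    L ⊕ (L ⊛ powerSum m 1 k′ ⊕ D ⊛ powerSum m 1 k′)  ≈⟨ ≗-sym (⊕-assoc L _ _) ⟩
    (L ⊕ L ⊛ powerSum m 1 k′) ⊕ D ⊛ powerSum m 1 k′  ≈⟨ ⊕-cong (≗-sym first-block) (λ _ → refl) ⟩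
    L ⊛ powerSum m 0 k ⊕ D ⊛ powerSum m 1 k′        ≈⟨ ⊕-cong (⊛-congʳ _ (weightSeries-ℓ̄inD m′)) (⊛-congʳ _ (weightSeries-inD m′)) ⟩
    gfℓ̄D (suc m′)                                   ∎
    where
    open ≗-Reasoning
    m = suc m′
    L = weightSeries ℓ̄inD m′
    D = weightSeries inD m′
    rec = ℓ̄inD-recurrence m′
    Y = withCopies ℓ̄inD m′
    above : Y 1 ≗ (L ⊕ D) ⊛ powerSum m 0 k′
    above = recurrence-finite rec 1 k′
      (λ { (suc j) _ j<k → ◃-both L D (<ᵇ-true j<k) (cong (_∧ true) (<ᵇ-true j<k)) })
      (λ j k≤j → ◃-neither L D (<ᵇ-false k≤j) (cong (_∧ not (j ≡ᵇ 0)) (<ᵇ-false k≤j)))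
    first-block : L ⊛ powerSum m 0 k ≗ L ⊕ L ⊛ powerSum m 1 k′
    first-block = ≗-trans (⊛-distribˡ-⊕ L 𝟙 _) (⊕-cong (⊛-identityʳ L) (λ _ → refl))

  ℓ̄inO-recurrence : ∀ m′ → Recurrence (suc m′) (λ j → ((j ≡ᵇ 0) ∨ not (divides? k (suc m′))) ◃ weightSeries ℓ̄inO m′
                                                    ⊕ (((j ≡ᵇ 0) ∨ not (divides? k (suc m′))) ∧ not (j ≡ᵇ 0)) ◃ weightSeries inO m′)
                                               (withCopies ℓ̄inO m′)
  ℓ̄inO-recurrence m′ = multiplicity-recurrence m′ {ℓ̄inO} α ℓ̄inO (λ j → α j ∧ not (j ≡ᵇ 0)) inO
    (λ j μ μ≤m′ → trans (cong₂ (λ b ℓ → if b then ℓ else 0) (isO-prepend μ≤m′ k j) (distinctParts-prepend μ≤m′ j))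
                        (distinct-if (α j) (isO k μ) (not (j ≡ᵇ 0)) (distinctParts μ)))
    where
    α : ℕ → Bool
    α j = (j ≡ᵇ 0) ∨ not (divides? k (suc m′))

  weightSeries-ℓ̄inO : ∀ m → weightSeries ℓ̄inO m ≗ gfℓ̄O m
  weightSeries-ℓ̄inO zero     = weightSeries-zero ℓ̄inO
  weightSeries-ℓ̄inO (suc m′) with divides? k (suc m′) in k∣m
  ... | true  = ≗-trans
    (recurrence-finite (ℓ̄inO-recurrence m′) 0 1
      (λ { zero _ _ → ◃-first L O refl refl ; (suc j) _ (s≤s ()) })
      (λ { (suc j) _ → ◃-neither L O (cong not k∣m) (cong (λ b → not b ∧ true) k∣m) }))
    (≗-trans (⊛-congˡ L (powerSum-one (suc m′))) (≗-trans (⊛-identityʳ L) (weightSeries-ℓ̄inO m′)))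
    where
    L = weightSeries ℓ̄inO m′
    O = weightSeries inO m′
  ... | false = begin
    Y 0                                            ≈⟨ Recurrence.step rec 0 ⟩
    (L ⊕ 𝟘) ⊕ shift m (Y 1)                       ≈⟨ ⊕-cong (⊕-identityʳ L) (shift-cong m above) ⟩
    L ⊕ shift m ((L ⊕ O) ⊛ geometric m)            ≈⟨ ⊕-cong (weightSeries-ℓ̄inO m′)
                                                             (shift-cong m (⊛-congʳ _ (⊕-cong (weightSeries-ℓ̄inO m′) (weightSeries-inO m′)))) ⟩
    gfℓ̄O m′ ⊕ shift m ((gfℓ̄O m′ ⊕ gfO m′) ⊛ geometric m) ∎
    where
    open ≗-Reasoning
    m = suc m′
    L = weightSeries ℓ̄inO m′
    O = weightSeries inO m′
    rec = ℓ̄inO-recurrence m′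
    Y = withCopies ℓ̄inO m′
    above : Y 1 ≗ (L ⊕ O) ⊛ geometric m
    above = recurrence-geometric rec 1
      (λ { (suc j) _ → ◃-both L O (cong not k∣m) (cong (λ b → not b ∧ true) k∣m) })

  length-𝒯 : ∀ n → length (𝒯 k n) ≡ gfT n n
  length-𝒯 n = trans (length-filterᵇ (isT k) (partitions n)) (weightSeries-inT n n)

  sumDistinct-𝒟 : ∀ n → sumDistinct (𝒟 k n) ≡ gfℓ̄D n n
  sumDistinct-𝒟 n = trans (sum-map-filterᵇ (isD k) distinctParts (partitions n)) (weightSeries-ℓ̄inD n n)

  sumDistinct-𝒪 : ∀ n → sumDistinct (𝒪 k n) ≡ gfℓ̄O n n
  sumDistinct-𝒪 n = trans (sum-map-filterᵇ (isO k) distinctParts (partitions n)) (weightSeries-ℓ̄inO n n)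

  -- Glaisher's theorem and the identity of generating functions

  powers kPowers nonMultiplePowers : ℕ → Series
  powers zero                = 𝟘
  powers (suc m′)            = powers m′ ⊕ monomial (suc m′)
  kPowers zero               = 𝟘
  kPowers (suc m′)           = kPowers m′ ⊕ monomial (k * suc m′)
  nonMultiplePowers zero     = 𝟘
  nonMultiplePowers (suc m′) = if divides? k (suc m′) then nonMultiplePowers m′
                               else nonMultiplePowers m′ ⊕ monomial (suc m′)

  gfℓ̄D-difference : ∀ m → gfℓ̄D m ⊕ gfD m ⊛ kPowers m ≗ gfT m ⊕ gfD m ⊛ powers m
  gfℓ̄D-difference zero     n = cong₂ _+_ refl (trans (⊛-zeroʳ 𝟙 n) (sym (⊛-zeroʳ 𝟙 n)))
  gfℓ̄D-difference (suc m′) = begin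
    (L ⊛ G ⊕ D ⊛ powerSum m 1 k′) ⊕ (D ⊛ G) ⊛ (kPowers m′ ⊕ monomial (k * m))
      ≈⟨ ⊕-cong (λ _ → refl) (⊛-⊕-monomial D G (kPowers m′) (k * m)) ⟩
    (L ⊛ G ⊕ D ⊛ powerSum m 1 k′) ⊕ ((D ⊛ kPowers m′) ⊛ G ⊕ D ⊛ shift (k * m) G)
      ≈⟨ ⊕-interchange (L ⊛ G) (D ⊛ powerSum m 1 k′) ((D ⊛ kPowers m′) ⊛ G) (D ⊛ shift (k * m) G) ⟩
    (L ⊛ G ⊕ (D ⊛ kPowers m′) ⊛ G) ⊕ (D ⊛ powerSum m 1 k′ ⊕ D ⊛ shift (k * m) G)
      ≈⟨ ⊕-cong (≗-sym (⊛-distribʳ-⊕ G L _)) (≗-sym (⊛-distribˡ-⊕ D _ _)) ⟩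
    (L ⊕ D ⊛ kPowers m′) ⊛ G ⊕ D ⊛ (powerSum m 1 k′ ⊕ shift (k * m) G)
      ≈⟨ ⊕-cong (⊛-congʳ G (gfℓ̄D-difference m′)) (⊛-congˡ D (powerSum-split m k′)) ⟩
    (T′ ⊕ D ⊛ powers m′) ⊛ G ⊕ D ⊛ (powerSum m (suc k) k′ ⊕ shift m G)
      ≈⟨ ⊕-cong (⊛-distribʳ-⊕ G T′ _) (⊛-distribˡ-⊕ D _ _) ⟩
    (T′ ⊛ G ⊕ (D ⊛ powers m′) ⊛ G) ⊕ (D ⊛ powerSum m (suc k) k′ ⊕ D ⊛ shift m G)
      ≈⟨ ⊕-interchange (T′ ⊛ G) ((D ⊛ powers m′) ⊛ G) (D ⊛ powerSum m (suc k) k′) (D ⊛ shift m G) ⟩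
    (T′ ⊛ G ⊕ D ⊛ powerSum m (suc k) k′) ⊕ ((D ⊛ powers m′) ⊛ G ⊕ D ⊛ shift m G)
      ≈⟨ ⊕-cong (λ _ → refl) (≗-sym (⊛-⊕-monomial D G (powers m′) m)) ⟩
    (T′ ⊛ G ⊕ D ⊛ powerSum m (suc k) k′) ⊕ (D ⊛ G) ⊛ (powers m′ ⊕ monomial m) ∎
    where
    open ≗-Reasoning
    m = suc m′
    G = powerSum m 0 k
    D = gfD m′
    L = gfℓ̄D m′
    T′ = gfT m′

  gfℓ̄O-factor : ∀ m → gfℓ̄O m ≗ gfO m ⊛ nonMultiplePowers m
  gfℓ̄O-factor zero     n = sym (⊛-zeroʳ 𝟙 n)
  gfℓ̄O-factor (suc m′) with divides? k (suc m′)
  ... | true  = gfℓ̄O-factor m′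
  ... | false = begin
    L ⊕ shift m ((L ⊕ O) ⊛ g)                          ≈⟨ ⊕-cong (λ _ → refl) (shift-cong m (⊛-distribʳ-⊕ g L O)) ⟩
    L ⊕ shift m (L ⊛ g ⊕ O ⊛ g)                        ≈⟨ ⊕-cong (λ _ → refl) (shift-⊕ m _ _) ⟩
    L ⊕ (shift m (L ⊛ g) ⊕ shift m (O ⊛ g))            ≈⟨ ≗-sym (⊕-assoc L _ _) ⟩
    (L ⊕ shift m (L ⊛ g)) ⊕ shift m (O ⊛ g)            ≈⟨ ⊕-cong (≗-sym (⊛-geometric m′ L)) (≗-sym (⊛-shift m O g)) ⟩
    L ⊛ g ⊕ O ⊛ shift m g                              ≈⟨ ⊕-cong (⊛-congʳ g (gfℓ̄O-factor m′)) (λ _ → refl) ⟩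
    (O ⊛ nonMultiplePowers m′) ⊛ g ⊕ O ⊛ shift m g     ≈⟨ ≗-sym (⊛-⊕-monomial O g (nonMultiplePowers m′) m) ⟩
    (O ⊛ g) ⊛ (nonMultiplePowers m′ ⊕ monomial m)      ∎
    where
    open ≗-Reasoning
    m = suc m′
    g = geometric m
    L = gfℓ̄O m′
    O = gfO m′

  divides?-sound : ∀ {x} → divides? k x ≡ true → k ∣ x
  divides?-sound {x} k∣x = m%n≡0⇒n∣m x k (≡ᵇ⇒≡ (x % k) 0 (subst T (sym k∣x) _))

  divides?-complete : ∀ {x} → k ∣ x → divides? k x ≡ true
  divides?-complete {x} k∣x = dec-true ((x % k) ≟ 0) (n∣m⇒m%n≡0 x k k∣x)

  -- multiples m = ⌊m / k⌋
  multiples : ℕ → ℕ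
  multiples zero     = 0
  multiples (suc m′) = if divides? k (suc m′) then suc (multiples m′) else multiples m′

  multiples-bounds : ∀ m → k * multiples m ≤ m × m < k * suc (multiples m)
  multiples-suc-∣ : ∀ m′ → divides? k (suc m′) ≡ true → k * suc (multiples m′) ≡ suc m′

  multiples-suc-∣ m′ k∣m =
    let (lo , hi) = multiples-bounds m′ in sym (∣-between k′ (divides?-sound k∣m) (s≤s lo) hi)

  multiples-bounds zero     = ≤-reflexive (*-zeroʳ k) , subst (0 <_) (sym (*-identityʳ k)) (s≤s z≤n)
  multiples-bounds (suc m′) with divides? k (suc m′) in k∣m
  ... | true  = ≤-reflexive (multiples-suc-∣ m′ k∣m) ,
                subst (_< k * suc (suc c)) (multiples-suc-∣ m′ k∣m) (*-monoʳ-< k (n<1+n (suc c)))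
    where c = multiples m′
  ... | false = ≤-trans lo (n≤1+n m′) , ≤∧≢⇒< hi next-not-multiple
    where
    c = multiples m′
    lo = proj₁ (multiples-bounds m′)
    hi = proj₂ (multiples-bounds m′)
    next-not-multiple : suc m′ ≢ k * suc c
    next-not-multiple m≡kc with trans (sym (divides?-complete (divides (suc c) (trans m≡kc (*-comm k (suc c)))))) k∣m
    ... | ()

  multiples≤ : ∀ m → multiples m ≤ m
  multiples≤ m = ≤-trans (m≤m+n (multiples m) (k′ * multiples m)) (proj₁ (multiples-bounds m))

  settled : (F : ℕ → Series) → (∀ i n → n < k * suc i → F (suc i) n ≡ F i n) →
            ∀ m n → n ≤ m → F m n ≡ F (multiples m) n
  settled F step m n n≤m =
    trans (cong (λ i → F i n) (sym (m∸n+n≡m (multiples≤ m)))) (stable (m ∸ c) (≤-<-trans n≤m (proj₂ (multiples-bounds m))))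
    where
    c = multiples m
    stable : ∀ d → n < k * suc c → F (d + c) n ≡ F c n
    stable zero    n<kc = refl
    stable (suc d) n<kc = trans (step (d + c) n (<-≤-trans n<kc (*-monoʳ-≤ k (s≤s (m≤n+m c d))))) (stable d n<kc)

  gfP gfE : ℕ → Series
  gfP zero     = 𝟙
  gfP (suc m′) = gfP m′ ⊛ geometric (suc m′)
  gfE zero     = 𝟙
  gfE (suc i)  = gfE i ⊛ geometric (k * suc i)

  gfE-zero : ∀ i → gfE i 0 ≡ 1
  gfE-zero zero    = refl
  gfE-zero (suc i) = cong₂ _*_ (gfE-zero i) (geometric-∣ ((k * suc i) ∣0))

  gfD⊛gfE : ∀ m → gfD m ⊛ gfE m ≗ gfP m
  gfD⊛gfE zero     = ⊛-identityˡ 𝟙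
  gfD⊛gfE (suc m′) = ≗-trans (⊛-interchange (gfD m′) (powerSum (suc m′) 0 k) (gfE m′) (geometric (k * suc m′)))
                             (⊛-cong (gfD⊛gfE m′) (powerSum-⊛-geometric m′ k′))

  gfO⊛gfE : ∀ m → gfO m ⊛ gfE (multiples m) ≗ gfP m
  gfO⊛gfE zero     = ⊛-identityˡ 𝟙
  gfO⊛gfE (suc m′) with divides? k (suc m′) in k∣m
  ... | true  = ≗-trans (≗-sym (⊛-assoc (gfO m′) (gfE (multiples m′)) _))
                        (⊛-cong (gfO⊛gfE m′) (λ n → cong (λ e → geometric e n) (multiples-suc-∣ m′ k∣m)))
  ... | false = begin
    (gfO m′ ⊛ g) ⊛ E      ≈⟨ ⊛-assoc (gfO m′) g E ⟩
    gfO m′ ⊛ (g ⊛ E)      ≈⟨ ⊛-congˡ (gfO m′) (⊛-comm g E) ⟩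
    gfO m′ ⊛ (E ⊛ g)      ≈⟨ ≗-sym (⊛-assoc (gfO m′) E g) ⟩
    (gfO m′ ⊛ E) ⊛ g      ≈⟨ ⊛-congʳ g (gfO⊛gfE m′) ⟩
    gfP m′ ⊛ g            ∎
    where
    open ≗-Reasoning
    g = geometric (suc m′)
    E = gfE (multiples m′)

  glaisher : ∀ m n → n ≤ m → gfO m n ≡ gfD m n
  glaisher m = ⊛-cancelʳ m (gfE-zero m) (λ n n≤m → begin
    (gfO m ⊛ gfE m) n                ≡⟨ ⊛-agree n (λ _ _ → refl) (λ i i≤n → settled gfE gfE-step m i (≤-trans i≤n n≤m)) ⟩
    (gfO m ⊛ gfE (multiples m)) n    ≡⟨ gfO⊛gfE m n ⟩
    gfP m n                          ≡⟨ gfD⊛gfE m n ⟨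
    (gfD m ⊛ gfE m) n                ∎)
    where
    open ≡-Reasoning
    gfE-step : ∀ i n → n < k * suc i → gfE (suc i) n ≡ gfE i n
    gfE-step i n n<ki = ⊛-geometric-below _ (gfE i) n<ki

  powers-split : ∀ m → powers m ≗ nonMultiplePowers m ⊕ kPowers (multiples m)
  powers-split zero     n = refl
  powers-split (suc m′) with divides? k (suc m′) in k∣m
  ... | true  = λ n → trans (cong (_+ monomial (suc m′) n) (powers-split m′ n))
      (trans (+-assoc (nonMultiplePowers m′ n) _ _)
             (cong (λ e → nonMultiplePowers m′ n + (kPowers (multiples m′) n + monomial e n)) (sym (multiples-suc-∣ m′ k∣m))))
  ... | false = λ n → trans (cong (_+ monomial (suc m′) n) (powers-split m′ n))
                          (xy∙z≈xz∙y (nonMultiplePowers m′ n) (kPowers (multiples m′) n) (monomial (suc m′) n))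

  kPowers-settled : ∀ m n → n ≤ m → kPowers m n ≡ kPowers (multiples m) n
  kPowers-settled = settled kPowers (λ i n n<ki → trans (cong (kPowers i n +_) (shift-below (k * suc i) 𝟙 n<ki)) (+-identityʳ _))

  gfℓ̄D≡gfT+gfℓ̄O : ∀ n → gfℓ̄D n n ≡ gfT n n + gfℓ̄O n n
  gfℓ̄D≡gfT+gfℓ̄O n = +-cancelʳ-≡ X (gfℓ̄D n n) (gfT n n + gfℓ̄O n n) (begin
    gfℓ̄D n n + X                                ≡⟨ cong (gfℓ̄D n n +_) (⊛-agree n (λ _ _ → refl) (λ i i≤n → kPowers-settled n i i≤n)) ⟨
    gfℓ̄D n n + (D ⊛ kPowers n) n                 ≡⟨ gfℓ̄D-difference n n ⟩
    gfT n n + (D ⊛ powers n) n                   ≡⟨ cong (gfT n n +_) (⊛-congˡ D (powers-split n) n) ⟩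
    gfT n n + (D ⊛ (U ⊕ kPowers (multiples n))) n ≡⟨ cong (gfT n n +_) (⊛-distribˡ-⊕ D U _ n) ⟩
    gfT n n + ((D ⊛ U) n + X)                    ≡⟨ +-assoc (gfT n n) _ X ⟨
    gfT n n + (D ⊛ U) n + X                      ≡⟨ cong (λ y → gfT n n + y + X) ℓ̄O≡D⊛U ⟨
    gfT n n + gfℓ̄O n n + X                       ∎)
    where
    open ≡-Reasoning
    D = gfD n
    U = nonMultiplePowers n
    X = (D ⊛ kPowers (multiples n)) n
    ℓ̄O≡D⊛U : gfℓ̄O n n ≡ (D ⊛ U) n
    ℓ̄O≡D⊛U = trans (gfℓ̄O-factor n n) (⊛-agree n (λ i i≤n → glaisher n i i≤n) (λ _ _ → refl))

-- Imported last: the prefix +_ of Data.Integer would make the sections (x +_) above ambiguous.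
open import Data.Integer using (+_; _-_)
open import Data.Integer.Properties using ([+m]-[+n]≡m⊖n; ⊖-≥)

+[m+n]-+n≡+m : ∀ m n → + (m + n) - + n ≡ + m
+[m+n]-+n≡+m m n = trans ([+m]-[+n]≡m⊖n (m + n) n) (trans (⊖-≥ (m≤n+m n m)) (cong +_ (m+n∸n≡m m n)))

theorem1p9 : (k n : ℕ) → k ≥ 1 →
    + length (𝒯 k n) ≡ + sumDistinct (𝒟 k n) - + sumDistinct (𝒪 k n)
theorem1p9 (suc k′) n _ = begin
  + length (𝒯 (suc k′) n)                          ≡⟨ cong +_ (length-𝒯 k′ n) ⟩
  + gfT k′ n n                                     ≡⟨ +[m+n]-+n≡+m (gfT k′ n n) (gfℓ̄O k′ n n) ⟨
  + (gfT k′ n n + gfℓ̄O k′ n n) - + gfℓ̄O k′ n n    ≡⟨ cong₂ (λ a b → + a - + b) 𝒟-side (sumDistinct-𝒪 k′ n) ⟨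
  + sumDistinct (𝒟 (suc k′) n) - + sumDistinct (𝒪 (suc k′) n) ∎
  where
  open ≡-Reasoning
  𝒟-side : sumDistinct (𝒟 (suc k′) n) ≡ gfT k′ n n + gfℓ̄O k′ n n
  𝒟-side = trans (sumDistinct-𝒟 k′ n) (gfℓ̄D≡gfT+gfℓ̄O k′ n)
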